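{- Let $n\ge 0$. For every Cayley tree $T$ labelled with $[n]_0$ and every parking function $\pi$ of length $n$ consider the hexads $$(\mathrm{Rec}(T),\ \mathrm{wait}(T),\ \mathrm{psa}(T),\ \deg_\circ(T),\ \mathrm{chseq}(T),\ \mathrm{ord}(T))\quad\text{and}\quad(\mathrm{Rec}(\pi),\ \mathrm{probes}(\pi),\ \mathrm{lucky}(\pi),\ \mathrm{ones}(\pi),\ \mathrm{mult}(\pi),\ \mathrm{len}(\pi)).$$ These hexads are equidistributed: for every possible value $v$, the number of Cayley trees $T$ labelled with $[n]_0$ whose first hexad equals $v$ equals the number of parking functions $\pi$ of length $n$ whose second hexad equals $v$.
   Context: $[n]=\{1,\dots,n\}$, $[n]_0=\{0,1,\dots,n\}$. A Cayley tree labelled with $[n]_0$ is a tree on vertex set $[n]_0$ rooted at $0$ (the root, also written $\circ$); $f_T:[n]\to[n]_0$ denotes its parent map. A non-root vertex $k$ is a record of $T$ if $k$ is the largest label on the path from $k$ to the root; $\mathrm{Rec}(T)$ is the set of records. The weary permutation $\omega_T$ of $T$: run priority-first search from $0$ (at each step visit the smallest unvisited vertex adjacent to an already visited vertex); $\omega_T(i)$ is the $i$-th non-root vertex visited, and $\omega_T(0)=0$. The priority tree $\mathrm{pt}(T)$ is the tree obtained from $T$ by relabelling each vertex $v$ as $\omega_T^{ -1}(v)$. Statistics on $T$: $\mathrm{ord}(T)=n$; $\deg_\circ(T)$ = number of children of the root; $\mathrm{chseq}(T)=(\tau_0,\dots,\tau_n)$ where $\tau_i$ is the number of vertices of $T$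 (root included) with exactly $i$ children; $\mathrm{wait}(T)=\sum_{i=1}^n (i-f_{\mathrm{pt}(T)}(i))$; $\mathrm{psa}(T)$ = number of $i\in[n]$ with $f_{\mathrm{pt}(T)}(i)=i-1$. A parking function of length $n$ is a sequence $\pi=(a_1,\dots,a_n)$ with $a_i\in[n]$ such that, when cars $1,2,\dots,n$ enter in this order a street with spots $1,\dots,n$ and car $i$ parks in the first unoccupied spot $j\ge a_i$, every car parks. $\omega_\pi(j)$ denotes the car parked in spot $j$ (the bird's eye permutation). $\mathrm{Rec}(\pi)$ is the set of left-to-right maxima of the word $\omega_\pi(1)\omega_\pi(2)\cdots\omega_\pi(n)$. Statistics: $\mathrm{len}(\pi)=n$; $\mathrm{lucky}(\pi)$ = number of cars parking in their preferred spot; the displacement $\mathrm{dis}(\pi)$ is the total number of failed attempts (sum over cars of final spot minus preferred spot) and $\mathrm{probes}(\pi)=\mathrm{dis}(\pi)+n$; $\mathrm{ones}(\pi)$ = number of $i$ with $a_i=1$; $\mathrm{mult}(\pi)=(\mu_0,\dots,\mu_n)$ where $\mu_i$ is the number of elements of $[n+1]$ appearing exactly $i$ times in $\pi$. -}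

module Defs where

open import Data.Nat using (ℕ; zero; suc; _+_; _∸_; _≤ᵇ_; _<ᵇ_; _≡ᵇ_)
import Data.Nat.Properties as ℕP
open import Data.Bool using (Bool; true; false; _∧_; _∨_; not; if_then_else_)
import Data.Bool.Properties as BoolP
open import Data.Fin using (Fin; zero; suc; toℕ; inject₁)
import Data.Fin.Properties as FinP
open import Data.Fin.Subset using (Subset)
open import Data.Vec using (Vec; []; _∷_; lookup; tabulate; replicate; _[_]≔_)
import Data.Vec.Properties as VecP
open import Data.List using (List; []; _∷_; map; concatMap; allFin; filterᵇ; length; head)
open import Data.Nat.ListAction using (sum)
open import Data.Bool.ListAction using (any; all)
open import Data.Maybe using (Maybe; just; nothing; fromMaybe; is-just)
import Data.Maybe as Maybe
open import Data.Product using (_×_; _,_)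
import Data.Product.Properties as ProdP
open import Relation.Nullary.Decidable using (⌊_⌋)
open import Relation.Binary.Definitions using (DecidableEquality)

countᵇ : {A : Set} → (A → Bool) → List A → ℕ
countᵇ p xs = length (filterᵇ p xs)

allVecs : (m k : ℕ) → List (Vec (Fin m) k)
allVecs m zero = [] ∷ []
allVecs m (suc k) = concatMap (λ x → map (x ∷_) (allVecs m k)) (allFin m)

_==_ : {m : ℕ} → Fin m → Fin m → Bool
i == j = ⌊ i FinP.≟ j ⌋

iter : {A : Set} → ℕ → (A → A) → A → A
iter zero g x = x
iter (suc k) g x = g (iter k g x)

-- Vertex v ∈ [n]_0 is represented by (v : Fin (suc n)) with toℕ v = label;
-- the root 0 is `zero`.  A non-root vertex k ∈ [n] is `suc i` with i : Fin n.
-- A labelled tree rooted at 0 is given by its parent map f_T : [n] → [n]_0,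
-- represented as a vector  f : Vec (Fin (suc n)) n  (entry i = parent of suc i),
-- subject to acyclicity: every vertex reaches the root by following parents.

ParentMap : ℕ → Set
ParentMap n = Vec (Fin (suc n)) n

up : {n : ℕ} → ParentMap n → Fin (suc n) → Fin (suc n)
up f zero = zero
up f (suc i) = lookup f i

isTree : {n : ℕ} → ParentMap n → Bool
isTree {n} f = all (λ i → iter n (up f) (suc i) == zero) (allFin n)

CayleyTrees : (n : ℕ) → List (ParentMap n)
CayleyTrees n = filterᵇ isTree (allVecs (suc n) n)

-- Records: k is a record iff every vertex on the path from k to the root
-- (the iterates up^m(k), 0 ≤ m ≤ n, which cover the whole path) has label ≤ k.
RecT : {n : ℕ} → ParentMap n → Subset n
RecT {n} f = tabulate λ i →
  all (λ m → toℕ (iter (toℕ m) (up f) (suc i)) ≤ᵇ toℕ (suc i)) (allFin (suc n))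

adj : {n : ℕ} → ParentMap n → Fin (suc n) → Fin (suc n) → Bool
adj f zero zero = false
adj f zero (suc j) = lookup f j == zero
adj f (suc i) w = (lookup f i == w) ∨ (adj′ w)
  where
  adj′ : Fin _ → Bool
  adj′ zero = false
  adj′ (suc j) = lookup f j == suc i

pfs : {n : ℕ} → ParentMap n → ℕ → Vec Bool (suc n) → List (Fin (suc n))
pfs f zero vis = []
pfs {n} f (suc fuel) vis with head (filterᵇ (λ u → not (lookup vis u) ∧
                                  any (λ w → lookup vis w ∧ adj f u w) (allFin (suc n)))
                                (allFin (suc n)))
... | nothing = []
... | just u = u ∷ pfs f fuel (vis [ u ]≔ true)

nthOr : {A : Set} → A → List A → ℕ → A
nthOr d [] k = d
nthOr d (x ∷ xs) zero = x
nthOr d (x ∷ xs) (suc k) = nthOr d xs k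

posOr : {m : ℕ} → List (Fin m) → Fin m → ℕ
posOr [] v = zero
posOr (x ∷ xs) v = if x == v then zero else suc (posOr xs v)

visitOrder : {n : ℕ} → ParentMap n → List (Fin (suc n))
visitOrder {n} f = zero ∷ pfs f n (true ∷ replicate n false)

ωT : {n : ℕ} → ParentMap n → Fin (suc n) → Fin (suc n)
ωT f i = nthOr zero (visitOrder f) (toℕ i)

ωT⁻¹ : {n : ℕ} → ParentMap n → Fin (suc n) → ℕ
ωT⁻¹ f v = posOr (visitOrder f) v

ptParent : {n : ℕ} → ParentMap n → Fin n → ℕ
ptParent f i = ωT⁻¹ f (up f (ωT f (suc i)))

wait : {n : ℕ} → ParentMap n → ℕ
wait {n} f = sum (map (λ i → toℕ (suc i) ∸ ptParent f i) (allFin n))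

-- psa(T) = #{ i ∈ [n] : f_pt(i) = i − 1 }
psa : {n : ℕ} → ParentMap n → ℕ
psa {n} f = countᵇ (λ i → ptParent f i ≡ᵇ toℕ i) (allFin n)

children : {n : ℕ} → ParentMap n → Fin (suc n) → ℕ
children {n} f v = countᵇ (λ j → lookup f j == v) (allFin n)

degRoot : {n : ℕ} → ParentMap n → ℕ
degRoot f = children f zero

chseq : {n : ℕ} → ParentMap n → Vec ℕ (suc n)
chseq {n} f = tabulate λ i → countᵇ (λ v → children f v ≡ᵇ toℕ i) (allFin (suc n))

ord : {n : ℕ} → ParentMap n → ℕ
ord {n} f = n

-- Parking functions of length n.
-- A preference sequence (a_1,…,a_n) ∈ [n]^n is a vector  a : Vec (Fin n) n,
-- with a_i = toℕ (lookup a (i-1)) + 1.  Spot j ∈ [n] is (j-1 : Fin n).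

Prefs : ℕ → Set
Prefs n = Vec (Fin n) n

firstFree : {n : ℕ} → Vec Bool n → Fin n → Maybe (Fin n)
firstFree {n} occ p = head (filterᵇ (λ j → (toℕ p ≤ᵇ toℕ j) ∧ not (lookup occ j)) (allFin n))

runParking : {n k : ℕ} → Vec Bool n → Vec (Fin n) k → Maybe (Vec (Fin n) k)
runParking occ [] = just []
runParking occ (p ∷ ps) with firstFree occ p
... | nothing = nothing
... | just j = Maybe.map (j ∷_) (runParking (occ [ j ]≔ true) ps)

isParkingFunction : {n : ℕ} → Prefs n → Bool
isParkingFunction {n} a = is-just (runParking (replicate n false) a)

ParkingFunctions : (n : ℕ) → List (Prefs n)
ParkingFunctions n = filterᵇ isParkingFunction (allVecs n n)

-- final spots of the cars (only meaningful for parking functions)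
spots : {n : ℕ} → Prefs n → Vec (Fin n) n
spots {n} a = fromMaybe a (runParking (replicate n false) a)

ωπ : {n : ℕ} → Prefs n → Fin n → Fin n
ωπ {n} a j = fromMaybe j (head (filterᵇ (λ c → lookup (spots a) c == j) (allFin n)))

RecP : {n : ℕ} → Prefs n → Subset n
RecP {n} a = tabulate λ c →
  any (λ j → (ωπ a j == c) ∧ all (λ k → (toℕ k <ᵇ toℕ j) ⇒ᵇ (toℕ (ωπ a k) <ᵇ toℕ c)) (allFin n))
      (allFin n)
  where
  _⇒ᵇ_ : Bool → Bool → Bool
  x ⇒ᵇ y = not x ∨ y

lucky : {n : ℕ} → Prefs n → ℕ
lucky {n} a = countᵇ (λ c → lookup (spots a) c == lookup a c) (allFin n)

dis : {n : ℕ} → Prefs n → ℕ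
dis {n} a = sum (map (λ c → toℕ (lookup (spots a) c) ∸ toℕ (lookup a c)) (allFin n))

probes : {n : ℕ} → Prefs n → ℕ
probes {n} a = dis a + n

ones : {n : ℕ} → Prefs n → ℕ
ones {n} a = countᵇ (λ c → toℕ (lookup a c) ≡ᵇ 0) (allFin n)

-- number of occurrences of the value k ∈ [n+1] (k = toℕ x + 1) in π
occurrences : {n : ℕ} → Prefs n → Fin (suc n) → ℕ
occurrences {n} a x = countᵇ (λ c → toℕ (lookup a c) ≡ᵇ toℕ x) (allFin n)

mult : {n : ℕ} → Prefs n → Vec ℕ (suc n)
mult {n} a = tabulate λ i → countᵇ (λ x → occurrences a x ≡ᵇ toℕ i) (allFin (suc n))

len : {n : ℕ} → Prefs n → ℕ
len {n} a = n

Hexad : ℕ → Set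
Hexad n = Subset n × ℕ × ℕ × ℕ × Vec ℕ (suc n) × ℕ

_≟H_ : {n : ℕ} → DecidableEquality (Hexad n)
_≟H_ = ProdP.≡-dec (VecP.≡-dec BoolP._≟_)
         (ProdP.≡-dec ℕP._≟_ (ProdP.≡-dec ℕP._≟_ (ProdP.≡-dec ℕP._≟_
           (ProdP.≡-dec (VecP.≡-dec ℕP._≟_) ℕP._≟_))))

hexadT : {n : ℕ} → ParentMap n → Hexad n
hexadT f = RecT f , wait f , psa f , degRoot f , chseq f , ord f

hexadP : {n : ℕ} → Prefs n → Hexad n
hexadP a = RecP a , probes a , lucky a , ones a , mult a , len a

#treesWith : (n : ℕ) → Hexad n → ℕ
#treesWith n v = countᵇ (λ f → ⌊ hexadT f ≟H v ⌋) (CayleyTrees n)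

#pfsWith : (n : ℕ) → Hexad n → ℕ
#pfsWith n v = countᵇ (λ a → ⌊ hexadP a ≟H v ⌋) (ParkingFunctions n)

-- Send a Cayley tree to the parking function in which car c prefers spot ω⁻¹(f c) + 1
-- and parks in spot ω⁻¹(c), ω being the priority-first visiting order.  Both processes
-- have a static description.  The visiting order is the only order in which parents come
-- before children and every vertex visited while c waits (after its parent, before c) is
-- smaller than c; a preference list parks cars in given spots iff every spot a car passes
-- is taken by an earlier car.  Under "visiting time = final spot" the two descriptions
-- coincide, so the map is a bijection (the parent of c is the car parked in c's preferred
-- spot) and the statistics translate one by one: wait is total displacement plus n, psa
-- counts lucky cars, children of the root are cars preferring spot 1, child counts become
-- multiplicities, and records are left-to-right maxima, because all ancestors of v are
-- smaller than v iff all vertices visited before v are.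
module Submission where

open import Defs
open import Data.Nat using (ℕ; zero; suc; _+_; _∸_; _≤_; _<_; z≤n; s≤s; _≤ᵇ_; _<ᵇ_; _≡ᵇ_; _<?_; ≢-nonZero)
import Data.Nat.Properties as ℕP
open import Algebra.Properties.CommutativeSemigroup ℕP.+-commutativeSemigroup using (x∙yz≈y∙xz)
open import Data.Nat.ListAction using (sum)
open import Data.Nat.ListAction.Properties using (sum-↭)
open import Data.Bool using (Bool; true; false; T; T?; not; _∧_; _∨_)
open import Data.Bool.Properties using (T-∧; T-∨)
open import Data.Bool.ListAction using (any; all)
open import Data.Unit using (tt)
open import Data.Empty using (⊥-elim)
open import Data.Fin using (Fin; zero; suc; toℕ; fromℕ<; inject₁)
import Data.Fin.Properties as FinP
open import Data.Vec using (Vec; []; _∷_; lookup; tabulate; replicate; _[_]≔_)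
import Data.Vec as Vec
import Data.Vec.Properties as VecP
open import Data.List using (List; []; _∷_; _++_; [_]; map; concatMap; allFin; filter; filterᵇ; length; head)
import Data.List as List
import Data.List.Properties as ListP
open import Data.List.Membership.Propositional using (_∈_; _∉_; find)
open import Data.List.Membership.Propositional.Properties
  using (∈-map⁺; ∈-map⁻; ∈-filter⁺; ∈-filter⁻; ∈-allFin; ∈-++⁺ˡ; ∈-++⁺ʳ; ∈-++⁻; ∈-concatMap⁺; ∈-concatMap⁻)
open import Data.List.Membership.Propositional.Properties.WithK using (unique∧set⇒bag)
open import Data.List.Relation.Unary.Any using (here; there)
import Data.List.Relation.Unary.Any as Any
import Data.List.Relation.Unary.Any.Properties as AnyP
open import Data.List.Relation.Unary.All using ([]; _∷_)
import Data.List.Relation.Unary.All as All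
import Data.List.Relation.Unary.All.Properties as AllP
open import Data.List.Relation.Unary.Unique.Propositional using (Unique)
import Data.List.Relation.Unary.Unique.Propositional.Properties as UniqueP
open import Data.List.Relation.Unary.AllPairs using ([]; _∷_)
open import Data.List.Relation.Binary.Permutation.Propositional using (_↭_)
import Data.List.Relation.Binary.Permutation.Propositional.Properties as PermP
open import Data.List.Relation.Binary.BagAndSetEquality using (∼bag⇒↭)
open import Data.Maybe using (just; nothing; fromMaybe)
import Data.Maybe.Properties as Maybe
open import Data.Product using (_×_; _,_; ∃; proj₁; proj₂)
open import Data.Sum using (_⊎_; inj₁; inj₂; [_,_]′)
open import Function using (_∘_; id; _⇔_; mk⇔; Equivalence)
open import Function.Definitions using (Injective)
open import Relation.Nullary using (¬_; yes; no; contradiction)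
open import Relation.Nullary.Decidable using (toWitness; fromWitness; ¬?; ⌊_⌋)
open import Relation.Binary.PropositionalEquality hiding ([_])
open import Relation.Binary.Definitions using (tri<; tri≈; tri>)

open Equivalence using (to; from)
import Function.Properties.Equivalence as ⇔

private
  variable
    A B : Set
    m : ℕ

T-injective : ∀ {x y} → (T x ⇔ T y) → x ≡ y
T-injective {false} {false} _ = refl
T-injective {false} {true}  x⇔y = ⊥-elim (from x⇔y tt)
T-injective {true}  {false} x⇔y = ⊥-elim (to x⇔y tt)
T-injective {true}  {true}  _ = refl

T-cong : ∀ {x y} → x ≡ y → T x ⇔ T y
T-cong x≡y = mk⇔ (subst T x≡y) (subst T (sym x≡y))

==⇔≡ : {i j : Fin m} → T (i == j) ⇔ i ≡ j
==⇔≡ = mk⇔ toWitness fromWitness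

≡ᵇ⇔≡ : ∀ {x y} → T (x ≡ᵇ y) ⇔ x ≡ y
≡ᵇ⇔≡ = mk⇔ (ℕP.≡ᵇ⇒≡ _ _) (ℕP.≡⇒≡ᵇ _ _)

≤ᵇ⇔≤ : ∀ {x y} → T (x ≤ᵇ y) ⇔ x ≤ y
≤ᵇ⇔≤ = mk⇔ (ℕP.≤ᵇ⇒≤ _ _) ℕP.≤⇒≤ᵇ

<ᵇ⇔< : ∀ {x y} → T (x <ᵇ y) ⇔ x < y
<ᵇ⇔< = mk⇔ (ℕP.<ᵇ⇒< _ _) ℕP.<⇒<ᵇ

T-not⇔¬T : ∀ {x} → T (not x) ⇔ (¬ T x)
T-not⇔¬T {false} = mk⇔ (λ _ ()) (λ _ → tt)
T-not⇔¬T {true} = mk⇔ (λ ()) (λ ¬tt → ¬tt tt)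

all-allFin⇔ : (p : Fin m → Bool) → T (all p (allFin m)) ⇔ (∀ i → T (p i))
all-allFin⇔ p = mk⇔ (AllP.tabulate⁻ ∘ AllP.all⁺ p _) (AllP.all⁻ p ∘ AllP.tabulate⁺)

any-allFin⇔ : (p : Fin m → Bool) → T (any p (allFin m)) ⇔ ∃ (T ∘ p)
any-allFin⇔ p = mk⇔ (AnyP.tabulate⁻ ∘ AnyP.any⁻ p _) (λ (i , pi) → AnyP.any⁺ p (AnyP.tabulate⁺ i pi))

lookup-set-true : ∀ (vs : Vec Bool m) i j → T (lookup (vs [ i ]≔ true) j) ⇔ (i ≡ j ⊎ T (lookup vs j))
lookup-set-true vs i j with i FinP.≟ j
... | yes refl = mk⇔ (λ _ → inj₁ refl) (λ _ → subst T (sym (VecP.lookup∘update i vs true)) tt)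
... | no i≢j = mk⇔ (inj₂ ∘ subst T (VecP.lookup∘update′ j≢i vs true))
                    λ { (inj₁ i≡j) → contradiction i≡j i≢j
                      ; (inj₂ vj) → subst T (sym (VecP.lookup∘update′ j≢i vs true)) vj }
  where
  j≢i : j ≢ i
  j≢i = i≢j ∘ sym

countᵇ-accept : (p : A → Bool) {x : A} (xs : List A) → T (p x) → countᵇ p (x ∷ xs) ≡ suc (countᵇ p xs)
countᵇ-accept p xs px = cong length (ListP.filter-accept (T? ∘ p) px)

countᵇ-reject : (p : A → Bool) {x : A} (xs : List A) → ¬ T (p x) → countᵇ p (x ∷ xs) ≡ countᵇ p xs
countᵇ-reject p xs ¬px = cong length (ListP.filter-reject (T? ∘ p) ¬px)

countᵇ-↭ : (p : A → Bool) {xs ys : List A} → xs ↭ ys → countᵇ p xs ≡ countᵇ p ys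
countᵇ-↭ p xs↭ys = PermP.↭-length (PermP.filter-↭ (T? ∘ p) xs↭ys)

countᵇ-map : (p : A → Bool) (f : B → A) (xs : List B) → countᵇ p (map f xs) ≡ countᵇ (p ∘ f) xs
countᵇ-map p f [] = refl
countᵇ-map p f (x ∷ xs) with T? (p (f x))
... | yes px = trans (countᵇ-accept p _ px) (trans (cong suc (countᵇ-map p f xs)) (sym (countᵇ-accept (p ∘ f) xs px)))
... | no ¬px = trans (countᵇ-reject p _ ¬px) (trans (countᵇ-map p f xs) (sym (countᵇ-reject (p ∘ f) xs ¬px)))

countᵇ-cong : {p q : A → Bool} (xs : List A) → (∀ {x} → x ∈ xs → T (p x) ⇔ T (q x)) →
              countᵇ p xs ≡ countᵇ q xs
countᵇ-cong [] _ = refl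
countᵇ-cong {p = p} {q} (x ∷ xs) p⇔q with T? (p x)
... | yes px = trans (countᵇ-accept p xs px)
                 (trans (cong suc (countᵇ-cong xs (p⇔q ∘ there))) (sym (countᵇ-accept q xs (to (p⇔q (here refl)) px))))
... | no ¬px = trans (countᵇ-reject p xs ¬px)
                 (trans (countᵇ-cong xs (p⇔q ∘ there)) (sym (countᵇ-reject q xs (¬px ∘ from (p⇔q (here refl))))))

sum-map-suc : (g : A → ℕ) (xs : List A) → sum (map (suc ∘ g) xs) ≡ length xs + sum (map g xs)
sum-map-suc g [] = refl
sum-map-suc g (x ∷ xs) = cong suc (trans (cong (g x +_) (sum-map-suc g xs)) (x∙yz≈y∙xz (g x) (length xs) _))

unique-sameMembers⇒↭ : {xs ys : List A} → Unique xs → Unique ys → (∀ {z} → z ∈ xs ⇔ z ∈ ys) → xs ↭ ys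
unique-sameMembers⇒↭ xs! ys! xs≈ys = ∼bag⇒↭ (unique∧set⇒bag xs! ys! xs≈ys)

countᵇ-bijection : {xs : List A} {ys : List B} (p : A → Bool) (q : B → Bool) (φ : A → B) (ψ : B → A) →
                   Unique xs → Unique ys →
                   (∀ {x} → x ∈ xs → φ x ∈ ys) → (∀ {y} → y ∈ ys → ψ y ∈ xs) →
                   (∀ {x} → x ∈ xs → ψ (φ x) ≡ x) → (∀ {y} → y ∈ ys → φ (ψ y) ≡ y) →
                   (∀ {x} → x ∈ xs → q (φ x) ≡ p x) → countᵇ p xs ≡ countᵇ q ys
countᵇ-bijection {xs = xs} {ys} p q φ ψ xs! ys! φ∈ ψ∈ ψφ φψ q∘φ = begin
  countᵇ p xs         ≡⟨ countᵇ-cong xs (T-cong ∘ sym ∘ q∘φ) ⟩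
  countᵇ (q ∘ φ) xs   ≡⟨ countᵇ-map q φ xs ⟨
  countᵇ q (map φ xs) ≡⟨ countᵇ-↭ q (unique-sameMembers⇒↭ φxs! ys! (mk⇔ into onto)) ⟩
  countᵇ q ys         ∎
  where
  open ≡-Reasoning
  φxs! : Unique (map φ xs)
  φxs! = UniqueP.map⁻ (subst Unique (sym ψφxs≡xs) xs!)
    where
    ψφxs≡xs : map ψ (map φ xs) ≡ xs
    ψφxs≡xs = begin
      map ψ (map φ xs) ≡⟨ ListP.map-∘ xs ⟨
      map (ψ ∘ φ) xs   ≡⟨ ListP.map-cong-local (All.tabulate ψφ) ⟩
      map id xs        ≡⟨ ListP.map-id xs ⟩
      xs               ∎
  into : ∀ {y} → y ∈ map φ xs → y ∈ ys
  into y∈ with x , x∈ , refl ← ∈-map⁻ φ y∈ = φ∈ x∈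
  onto : ∀ {y} → y ∈ ys → y ∈ map φ xs
  onto y∈ = subst (_∈ map φ xs) (φψ y∈) (∈-map⁺ φ (ψ∈ y∈))

module _ {m : ℕ} where
  open import Data.List.Membership.DecPropositional (FinP._≟_ {m}) using (_∈?_)

  unique-complete⇒length≡ : {V : List (Fin m)} → Unique V → (∀ u → u ∈ V) → length V ≡ m
  unique-complete⇒length≡ {V} V! V-complete = begin
    length V          ≡⟨ PermP.↭-length (unique-sameMembers⇒↭ V! (UniqueP.allFin⁺ m)
                                           (mk⇔ (λ _ → ∈-allFin _) (λ _ → V-complete _))) ⟩
    length (allFin m) ≡⟨ ListP.length-tabulate id ⟩
    m                 ∎
    where open ≡-Reasoning

  unique⇒length≤ : {V : List (Fin m)} → Unique V → length V ≤ m
  unique⇒length≤ {V} V! = begin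
    length V                 ≤⟨ ℕP.m≤m+n (length V) (length rest) ⟩
    length V + length rest   ≡⟨ ListP.length-++ V ⟨
    length (V ++ rest)       ≡⟨ unique-complete⇒length≡ V++rest! V++rest-complete ⟩
    m                        ∎
    where
    open ℕP.≤-Reasoning
    rest : List (Fin m)
    rest = filter (λ u → ¬? (u ∈? V)) (allFin m)
    V++rest! : Unique (V ++ rest)
    V++rest! = UniqueP.++⁺ V! (UniqueP.filter⁺ _ (UniqueP.allFin⁺ m))
                 (λ (u∈V , u∈rest) → proj₂ (∈-filter⁻ (λ u → ¬? (u ∈? V)) {xs = allFin m} u∈rest) u∈V)
    V++rest-complete : ∀ u → u ∈ V ++ rest
    V++rest-complete u with u ∈? V
    ... | yes u∈V = ∈-++⁺ˡ u∈V
    ... | no u∉V = ∈-++⁺ʳ V (∈-filter⁺ (λ u → ¬? (u ∈? V)) (∈-allFin u) u∉V)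

  unique-length≡⇒complete : {V : List (Fin m)} → Unique V → length V ≡ m → ∀ u → u ∈ V
  unique-length≡⇒complete {V} V! |V|≡m u with u ∈? V
  ... | yes u∈V = u∈V
  ... | no u∉V = contradiction (unique⇒length≤ (AllP.¬Any⇒All¬ V u∉V ∷ V!))
                               (ℕP.<-irrefl |V|≡m)

  unique-length<⇒missing : {V : List (Fin m)} → Unique V → length V < m → ∃ (_∉ V)
  unique-length<⇒missing {V} V! |V|<m =
    FinP.¬∀⟶∃¬ m (_∈ V) (_∈? V) (λ V-complete → ℕP.<-irrefl (unique-complete⇒length≡ V! V-complete) |V|<m)

module _ {m : ℕ} (π : Fin m → Fin m) (π-injective : Injective _≡_ _≡_ π) where

  private
    πs! : Unique (map π (allFin m))
    πs! = UniqueP.map⁺ π-injective (UniqueP.allFin⁺ m)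

    πs-complete : ∀ j → j ∈ map π (allFin m)
    πs-complete = unique-length≡⇒complete πs!
                    (trans (ListP.length-map π (allFin m)) (ListP.length-tabulate id))

  injective⇒surjective : ∀ j → ∃ λ i → π i ≡ j
  injective⇒surjective j with i , _ , j≡πi ← ∈-map⁻ π (πs-complete j) = i , sym j≡πi

  map-allFin-↭ : map π (allFin m) ↭ allFin m
  map-allFin-↭ = unique-sameMembers⇒↭ πs! (UniqueP.allFin⁺ m) (mk⇔ (λ _ → ∈-allFin _) (λ _ → πs-complete _))

  countᵇ-permute : (p : Fin m → Bool) → countᵇ (p ∘ π) (allFin m) ≡ countᵇ p (allFin m)
  countᵇ-permute p = trans (sym (countᵇ-map p π (allFin m))) (countᵇ-↭ p map-allFin-↭)

  sum-permute : (g : Fin m → ℕ) → sum (map (g ∘ π) (allFin m)) ≡ sum (map g (allFin m))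
  sum-permute g = trans (cong sum (ListP.map-∘ (allFin m))) (sum-↭ (PermP.map⁺ g map-allFin-↭))

Least : (Fin m → Set) → Fin m → Set
Least P u = P u × (∀ v → toℕ v < toℕ u → ¬ P v)

module _ (p : A → Bool) where

  head-filterᵇ-just⁻ : ∀ {m x} (g : Fin m → A) → head (filterᵇ p (List.tabulate g)) ≡ just x →
                       ∃ λ u → g u ≡ x × Least (T ∘ p ∘ g) u
  head-filterᵇ-just⁻ {suc m} g eq with p (g zero) in p0
  ... | true = zero , Maybe.just-injective eq , subst T (sym p0) tt , λ _ ()
  ... | false with u , gu≡x , pu , before-u ← head-filterᵇ-just⁻ (g ∘ suc) eq =
    suc u , gu≡x , pu , λ { zero _ → subst T p0 ; (suc v) v<u → before-u v (ℕP.≤-pred v<u) }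

  head-filterᵇ-just⁺ : ∀ {m} (g : Fin m → A) {u} → Least (T ∘ p ∘ g) u →
                       head (filterᵇ p (List.tabulate g)) ≡ just (g u)
  head-filterᵇ-just⁺ g {zero} (pu , _) = cong head (ListP.filter-accept (T? ∘ p) pu)
  head-filterᵇ-just⁺ g {suc u} (pu , before-u) =
    trans (cong head (ListP.filter-reject (T? ∘ p) (before-u zero (s≤s z≤n))))
          (head-filterᵇ-just⁺ (g ∘ suc) (pu , λ v v<u → before-u (suc v) (s≤s v<u)))

  head-filterᵇ-nothing : ∀ {m} (g : Fin m → A) → head (filterᵇ p (List.tabulate g)) ≡ nothing →
                         ∀ u → ¬ T (p (g u))
  head-filterᵇ-nothing {suc m} g eq u with p (g zero) in p0
  head-filterᵇ-nothing g ()  u       | true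
  head-filterᵇ-nothing g eq zero    | false = subst T p0
  head-filterᵇ-nothing g eq (suc u) | false = head-filterᵇ-nothing (g ∘ suc) eq u

Vec-ext : ∀ {xs ys : Vec A m} → (∀ i → lookup xs i ≡ lookup ys i) → xs ≡ ys
Vec-ext {xs = xs} {ys} lookup≡ = trans (sym (VecP.tabulate∘lookup xs)) (trans (VecP.tabulate-cong lookup≡) (VecP.tabulate∘lookup ys))

allVecs-complete : ∀ {m k} (v : Vec (Fin m) k) → v ∈ allVecs m k
allVecs-complete [] = here refl
allVecs-complete {m} {suc k} (x ∷ v) =
  ∈-concatMap⁺ (λ y → map (y ∷_) (allVecs m k)) (Any.map (λ { refl → ∈-map⁺ (x ∷_) (allVecs-complete v) }) (∈-allFin x))

∈-filterᵇ-allVecs : ∀ {m k} (p : Vec (Fin m) k → Bool) {v} → v ∈ filterᵇ p (allVecs m k) ⇔ T (p v)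
∈-filterᵇ-allVecs {m} {k} p {v} = mk⇔ (proj₂ ∘ ∈-filter⁻ (T? ∘ p) {xs = allVecs m k}) (∈-filter⁺ (T? ∘ p) (allVecs-complete v))

allVecs-unique : ∀ m k → Unique (allVecs m k)
allVecs-unique m zero = [] ∷ []
allVecs-unique m (suc k) = consAll! (UniqueP.allFin⁺ m)
  where
  vs : List (Vec (Fin m) k)
  vs = allVecs m k
  consAll! : {xs : List (Fin m)} → Unique xs → Unique (concatMap (λ x → map (x ∷_) vs) xs)
  consAll! [] = []
  consAll! {x ∷ xs} (x∉xs ∷ xs!) = UniqueP.++⁺ (UniqueP.map⁺ VecP.∷-injectiveʳ (allVecs-unique m k)) (consAll! xs!) disjoint
    where
    disjoint : ∀ {w} → ¬ (w ∈ map (x ∷_) vs × w ∈ concatMap (λ x → map (x ∷_) vs) xs)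
    disjoint (w∈x∷ , w∈rest) with _ , _ , refl ← ∈-map⁻ (x ∷_) w∈x∷
      with y , y∈xs , w∈y∷ ← find (∈-concatMap⁻ (λ x → map (x ∷_) vs) {xs = xs} w∈rest)
      with _ , _ , x∷≡y∷ ← ∈-map⁻ (y ∷_) w∈y∷ = All.lookup x∉xs y∈xs (VecP.∷-injectiveˡ x∷≡y∷)

module _ {m : ℕ} where
  open import Data.List.Membership.DecPropositional (FinP._≟_ {m}) using (_∈?_)

  posOr-here : (v : Fin m) (xs : List (Fin m)) → posOr (v ∷ xs) v ≡ 0
  posOr-here v xs with v FinP.≟ v
  ... | yes _ = refl
  ... | no v≢v = contradiction refl v≢v

  posOr-there : {x v : Fin m} (xs : List (Fin m)) → x ≢ v → posOr (x ∷ xs) v ≡ suc (posOr xs v)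
  posOr-there {x} {v} xs x≢v with x FinP.≟ v
  ... | yes x≡v = contradiction x≡v x≢v
  ... | no _ = refl

  posOr-∈ : {v : Fin m} (V : List (Fin m)) → v ∈ V → posOr V v < length V
  posOr-∈ {v} (x ∷ xs) v∈ with x FinP.≟ v | v∈
  ... | yes _ | _ = s≤s z≤n
  ... | no x≢v | here v≡x = contradiction (sym v≡x) x≢v
  ... | no _ | there v∈xs = s≤s (posOr-∈ xs v∈xs)

  posOr-∉ : {v : Fin m} (V : List (Fin m)) → v ∉ V → posOr V v ≡ length V
  posOr-∉ [] _ = refl
  posOr-∉ {v} (x ∷ xs) v∉ = trans (posOr-there xs (v∉ ∘ here ∘ sym)) (cong suc (posOr-∉ xs (v∉ ∘ there)))

  posOr-≤ : (v : Fin m) (V : List (Fin m)) → posOr V v ≤ length V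
  posOr-≤ v V with v ∈? V
  ... | yes v∈V = ℕP.<⇒≤ (posOr-∈ V v∈V)
  ... | no v∉V = ℕP.≤-reflexive (posOr-∉ V v∉V)

  posOr<length⇒∈ : {v : Fin m} (V : List (Fin m)) → posOr V v < length V → v ∈ V
  posOr<length⇒∈ {v} V pos< with v ∈? V
  ... | yes v∈V = v∈V
  ... | no v∉V = contradiction (posOr-∉ V v∉V) (ℕP.<⇒≢ pos<)

  nthOr-∈ : (d : Fin m) (V : List (Fin m)) {k : ℕ} → k < length V → nthOr d V k ∈ V
  nthOr-∈ d (x ∷ xs) {zero} _ = here refl
  nthOr-∈ d (x ∷ xs) {suc k} k< = there (nthOr-∈ d xs (ℕP.≤-pred k<))

  nthOr-posOr : (d : Fin m) {v : Fin m} (V : List (Fin m)) → v ∈ V → nthOr d V (posOr V v) ≡ v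
  nthOr-posOr d {v} (x ∷ xs) v∈ with x FinP.≟ v | v∈
  ... | yes x≡v | _ = x≡v
  ... | no x≢v | here v≡x = contradiction (sym v≡x) x≢v
  ... | no _ | there v∈xs = nthOr-posOr d xs v∈xs

  posOr-nthOr : (d : Fin m) (V : List (Fin m)) {k : ℕ} → Unique V → k < length V → posOr V (nthOr d V k) ≡ k
  posOr-nthOr d (x ∷ xs) {zero} _ _ = posOr-here x xs
  posOr-nthOr d (x ∷ xs) {suc k} (x∉xs ∷ xs!) k< =
    trans (posOr-there xs (All.lookup x∉xs (nthOr-∈ d xs (ℕP.≤-pred k<))))
          (cong suc (posOr-nthOr d xs xs! (ℕP.≤-pred k<)))

  posOr-++-∈ : {v : Fin m} (V W : List (Fin m)) → v ∈ V → posOr (V ++ W) v ≡ posOr V v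
  posOr-++-∈ {v} (x ∷ xs) W v∈ with x FinP.≟ v | v∈
  ... | yes _ | _ = refl
  ... | no x≢v | here v≡x = contradiction (sym v≡x) x≢v
  ... | no _ | there v∈xs = cong suc (posOr-++-∈ xs W v∈xs)

  posOr-++-∉ : {v : Fin m} (V W : List (Fin m)) → v ∉ V → posOr (V ++ W) v ≡ length V + posOr W v
  posOr-++-∉ [] W _ = refl
  posOr-++-∉ {v} (x ∷ xs) W v∉ = trans (posOr-there (xs ++ W) (v∉ ∘ here ∘ sym)) (cong suc (posOr-++-∉ xs W (v∉ ∘ there)))

  nthOr-++ˡ : (d : Fin m) (V W : List (Fin m)) {k : ℕ} → k < length V → nthOr d (V ++ W) k ≡ nthOr d V k
  nthOr-++ˡ d (x ∷ xs) W {zero} _ = refl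
  nthOr-++ˡ d (x ∷ xs) W {suc k} k< = nthOr-++ˡ d xs W (ℕP.≤-pred k<)

  nthOr-++ʳ : (d : Fin m) (V W : List (Fin m)) (k : ℕ) → nthOr d (V ++ W) (length V + k) ≡ nthOr d W k
  nthOr-++ʳ d [] W k = refl
  nthOr-++ʳ d (x ∷ xs) W k = nthOr-++ʳ d xs W k

  posOr-snoc-≤ : (v : Fin m) (V : List (Fin m)) (u : Fin m) → posOr (V ++ [ u ]) v ≤ suc (length V)
  posOr-snoc-≤ v V u = subst (posOr (V ++ [ u ]) v ≤_) (trans (ListP.length-++ V) (ℕP.+-comm (length V) 1)) (posOr-≤ v (V ++ [ u ]))

  posOr-snoc-∉ : {v : Fin m} (V : List (Fin m)) (u : Fin m) → v ∉ V → length V ≤ posOr (V ++ [ u ]) v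
  posOr-snoc-∉ V u v∉V = subst (length V ≤_) (sym (posOr-++-∉ V [ u ] v∉V)) (ℕP.m≤m+n (length V) _)

  posOr-snoc-new : (V : List (Fin m)) {u : Fin m} → u ∉ V → posOr (V ++ [ u ]) u ≡ length V
  posOr-snoc-new V {u} u∉V = trans (posOr-++-∉ V [ u ] u∉V) (trans (cong (length V +_) (posOr-here u [])) (ℕP.+-identityʳ _))

  nthOr-snoc-new : (d : Fin m) (V : List (Fin m)) (u : Fin m) → nthOr d (V ++ [ u ]) (length V) ≡ u
  nthOr-snoc-new d V u = subst (λ k → nthOr d (V ++ [ u ]) k ≡ u) (ℕP.+-identityʳ (length V)) (nthOr-++ʳ d V [ u ] 0)

-- Priority orders

-- vertexAt k is the vertex visited at time k (the root at time 0) and rank its inverse.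
-- A vertex becomes available when its parent is visited and the search always takes the
-- smallest available vertex, whence waiting-smaller.
record IsPriorityOrder {n : ℕ} (f : ParentMap n) (rank : Fin (suc n) → ℕ)
                       (vertexAt : Fin (suc n) → Fin (suc n)) : Set where
  field
    rank-vertexAt   : ∀ k → rank (vertexAt k) ≡ toℕ k
    vertexAt-rank   : ∀ v k → rank v ≡ toℕ k → vertexAt k ≡ v
    rank<           : ∀ v → rank v < suc n
    parent-first    : ∀ c → rank (lookup f c) < rank (suc c)
    waiting-smaller : ∀ c k → rank (lookup f c) < toℕ k → toℕ k < rank (suc c) →
                      toℕ (vertexAt k) < toℕ (suc c)

module PriorityOrder {n : ℕ} {f : ParentMap n} {rank : Fin (suc n) → ℕ} {vertexAt : Fin (suc n) → Fin (suc n)}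
                     (po : IsPriorityOrder f rank vertexAt) where
  open IsPriorityOrder po public

  index : Fin (suc n) → Fin (suc n)
  index v = fromℕ< (rank< v)

  toℕ-index : ∀ v → toℕ (index v) ≡ rank v
  toℕ-index v = FinP.toℕ-fromℕ< (rank< v)

  vertexAt-index : ∀ v → vertexAt (index v) ≡ v
  vertexAt-index v = vertexAt-rank v (index v) (sym (toℕ-index v))

  rank-injective : ∀ {u v} → rank u ≡ rank v → u ≡ v
  rank-injective {u} {v} ru≡rv = trans (sym (vertexAt-index u)) (vertexAt-rank v (index u) (trans (sym ru≡rv) (sym (toℕ-index u))))

  vertexAt-injective : ∀ {k l} → vertexAt k ≡ vertexAt l → k ≡ l
  vertexAt-injective {k} {l} eq = FinP.toℕ-injective (trans (sym (rank-vertexAt k)) (trans (cong rank eq) (rank-vertexAt l)))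

  vertexAt-zero : vertexAt zero ≡ zero
  vertexAt-zero with vertexAt zero in eq
  ... | zero = refl
  ... | suc c = contradiction (subst (rank (lookup f c) <_) (trans (cong rank (sym eq)) (rank-vertexAt zero)) (parent-first c)) λ ()

  rank-root : rank zero ≡ 0
  rank-root = trans (cong rank (sym vertexAt-zero)) (rank-vertexAt zero)

  rank≡0⇒root : ∀ {v} → rank v ≡ 0 → v ≡ zero
  rank≡0⇒root rv≡0 = rank-injective (trans rv≡0 (sym rank-root))

  ancestor-rank : ∀ m v → iter m (up f) v ≡ zero ⊎ rank (iter m (up f) v) + m ≤ rank v
  ancestor-rank zero v = inj₂ (ℕP.≤-reflexive (ℕP.+-identityʳ (rank v)))
  ancestor-rank (suc m) v with iter m (up f) v | ancestor-rank m v
  ... | zero | _ = inj₁ refl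
  ... | suc c | inj₂ r+m≤ = inj₂ (begin
    rank (lookup f c) + suc m ≡⟨ ℕP.+-suc (rank (lookup f c)) m ⟩
    suc (rank (lookup f c)) + m ≤⟨ ℕP.+-monoˡ-≤ m (parent-first c) ⟩
    rank (suc c) + m            ≤⟨ r+m≤ ⟩
    rank v                      ∎)
    where open ℕP.≤-Reasoning

  reaches-root : ∀ v → iter n (up f) v ≡ zero
  reaches-root v with ancestor-rank n v
  ... | inj₁ reached = reached
  ... | inj₂ r+n≤ = rank≡0⇒root (ℕP.n≤0⇒n≡0 (ℕP.+-cancelʳ-≤ n _ 0 (ℕP.≤-trans r+n≤ (ℕP.≤-pred (rank< v)))))

  isTree-holds : T (isTree f)
  isTree-holds = from (all-allFin⇔ _) (λ i → from ==⇔≡ (reaches-root (suc i)))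

module _ {n : ℕ} {f : ParentMap n} {ρ ρ′ : Fin (suc n) → ℕ} {σ σ′ : Fin (suc n) → Fin (suc n)}
         (po : IsPriorityOrder f ρ σ) (po′ : IsPriorityOrder f ρ′ σ′) where
  private
    module P = PriorityOrder po
    module P′ = PriorityOrder po′

  -- σ k is waiting in σ′ at time k, so σ′ visits a smaller vertex then.
  first-disagreement-smaller : ∀ k → (∀ j → toℕ j < toℕ k → σ j ≡ σ′ j) → σ k ≢ σ′ k → toℕ (σ′ k) < toℕ (σ k)
  first-disagreement-smaller k agree disagree with σ k in σk≡
  ... | zero = contradiction (sym σ′k≡zero) disagree
    where
    k≡zero : k ≡ zero
    k≡zero = FinP.toℕ-injective (trans (sym (P.rank-vertexAt k)) (trans (cong ρ σk≡) P.rank-root))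
    σ′k≡zero : σ′ k ≡ zero
    σ′k≡zero = trans (cong σ′ k≡zero) P′.vertexAt-zero
  ... | suc c = P′.waiting-smaller c k parent-before-k k-before-child
    where
    ρchild≡k : ρ (suc c) ≡ toℕ k
    ρchild≡k = trans (cong ρ (sym σk≡)) (P.rank-vertexAt k)
    parent-before-k : ρ′ (lookup f c) < toℕ k
    parent-before-k = begin-strict
      ρ′ (lookup f c)                ≡⟨ cong ρ′ (trans (sym (P.vertexAt-index (lookup f c))) (agree _ index<k)) ⟩
      ρ′ (σ′ (P.index (lookup f c))) ≡⟨ P′.rank-vertexAt _ ⟩
      toℕ (P.index (lookup f c))     <⟨ index<k ⟩
      toℕ k                          ∎
      where
      open ℕP.≤-Reasoning
      index<k : toℕ (P.index (lookup f c)) < toℕ k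
      index<k = subst₂ _<_ (sym (P.toℕ-index _)) ρchild≡k (P.parent-first c)
    k-before-child : toℕ k < ρ′ (suc c)
    k-before-child with ℕP.<-cmp (toℕ (P′.index (suc c))) (toℕ k)
    ... | tri< j<k _ _ = contradiction j<k (ℕP.<-irrefl (cong toℕ (P.vertexAt-injective
                           (trans (agree _ j<k) (trans (P′.vertexAt-index (suc c)) (sym σk≡))))))
    ... | tri≈ _ j≡k _ = contradiction (sym (trans (sym (cong σ′ (FinP.toℕ-injective j≡k))) (P′.vertexAt-index (suc c))))
                                       disagree
    ... | tri> _ _ k<j = subst (toℕ k <_) (P′.toℕ-index (suc c)) k<j

module _ {n : ℕ} {f : ParentMap n} {ρ ρ′ : Fin (suc n) → ℕ} {σ σ′ : Fin (suc n) → Fin (suc n)}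
         (po : IsPriorityOrder f ρ σ) (po′ : IsPriorityOrder f ρ′ σ′) where

  vertexAt-unique : ∀ k → σ k ≡ σ′ k
  vertexAt-unique k = agree-below (suc (toℕ k)) k ℕP.≤-refl
    where
    agree-below : ∀ b k → toℕ k < b → σ k ≡ σ′ k
    agree-below (suc b) k k<1+b with σ k FinP.≟ σ′ k
    ... | yes σk≡σ′k = σk≡σ′k
    ... | no σk≢σ′k = contradiction (first-disagreement-smaller po po′ k agree σk≢σ′k)
                        (ℕP.<-asym (first-disagreement-smaller po′ po k (λ j j<k → sym (agree j j<k)) (σk≢σ′k ∘ sym)))
      where
      agree : ∀ j → toℕ j < toℕ k → σ j ≡ σ′ j
      agree j j<k = agree-below b j (ℕP.<-≤-trans j<k (ℕP.≤-pred k<1+b))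

  rank-unique : ∀ v → ρ v ≡ ρ′ v
  rank-unique v = begin
    ρ v                  ≡⟨ P.toℕ-index v ⟨
    toℕ (P.index v)      ≡⟨ P′.rank-vertexAt (P.index v) ⟨
    ρ′ (σ′ (P.index v))  ≡⟨ cong ρ′ (trans (sym (vertexAt-unique (P.index v))) (P.vertexAt-index v)) ⟩
    ρ′ v                 ∎
    where
    open ≡-Reasoning
    module P = PriorityOrder po
    module P′ = PriorityOrder po′

crossing : (g : ℕ → ℕ) {t : ℕ} (N : ℕ) → t < g 0 → g N ≤ t → ∃ λ m → m < N × t < g m × g (suc m) ≤ t
crossing g zero t<g0 g0≤t = contradiction g0≤t (ℕP.<⇒≱ t<g0)
crossing g {t} (suc N) t<g0 g[1+N]≤t with g N ℕP.≤? t
... | no gN≰t = N , ℕP.≤-refl , ℕP.≰⇒> gN≰t , g[1+N]≤t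
... | yes gN≤t with m , m<N , above , below ← crossing g N t<g0 gN≤t = m , ℕP.m≤n⇒m≤1+n m<N , above , below

module _ {n : ℕ} {f : ParentMap n} {rank : Fin (suc n) → ℕ} {vertexAt : Fin (suc n) → Fin (suc n)}
         (po : IsPriorityOrder f rank vertexAt) where
  open PriorityOrder po

  ancestors-≤⇔earlier-< : ∀ v → (∀ (m : Fin (suc n)) → toℕ (iter (toℕ m) (up f) v) ≤ toℕ v) ⇔
                                (∀ k → toℕ k < rank v → toℕ (vertexAt k) < toℕ v)
  ancestors-≤⇔earlier-< v = mk⇔ earlier-< (λ earlier m → ancestors-≤ earlier (toℕ m))
    where
    ancestors-≤ : (∀ k → toℕ k < rank v → toℕ (vertexAt k) < toℕ v) → ∀ m → toℕ (iter m (up f) v) ≤ toℕ v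
    ancestors-≤ earlier zero = ℕP.≤-refl
    ancestors-≤ earlier (suc m) with iter (suc m) (up f) v | ancestor-rank (suc m) v
    ... | _ | inj₁ refl = z≤n
    ... | x | inj₂ r+1+m≤ = ℕP.<⇒≤ (subst (λ y → toℕ y < toℕ v) (vertexAt-index x)
                              (earlier (index x) (subst (_< rank v) (sym (toℕ-index x))
                                (ℕP.<-≤-trans (ℕP.m<m+n (rank x) (s≤s z≤n)) r+1+m≤))))

    -- Walk up from v to the ancestor u whose parent is visited at time ≤ k while u is visited
    -- after k: the vertex visited at time k is that parent, or was visited while u waited.
    earlier-< : (∀ (m : Fin (suc n)) → toℕ (iter (toℕ m) (up f) v) ≤ toℕ v) →
                ∀ k → toℕ k < rank v → toℕ (vertexAt k) < toℕ v
    earlier-< ancestors k k<rv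
      with m , m<n , above , below ← crossing (λ m → rank (iter m (up f) v)) n k<rv
                                       (ℕP.≤-trans (ℕP.≤-reflexive (trans (cong rank (reaches-root v)) rank-root)) z≤n)
      = visited-while-waiting (iter m (up f) v) above below (ancestor≤ m (ℕP.<⇒≤ m<n)) (ancestor≤ (suc m) m<n)
      where
      ancestor≤ : ∀ m → m ≤ n → toℕ (iter m (up f) v) ≤ toℕ v
      ancestor≤ m m≤n = subst (λ i → toℕ (iter i (up f) v) ≤ toℕ v) (FinP.toℕ-fromℕ< (s≤s m≤n)) (ancestors (fromℕ< (s≤s m≤n)))
      visited-while-waiting : ∀ u → toℕ k < rank u → rank (up f u) ≤ toℕ k → toℕ u ≤ toℕ v → toℕ (up f u) ≤ toℕ v →
                              toℕ (vertexAt k) < toℕ v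
      visited-while-waiting zero k<ru _ _ _ = contradiction (subst (toℕ k <_) rank-root k<ru) λ ()
      visited-while-waiting (suc c) k<ru rp≤k u≤v p≤v with ℕP.m≤n⇒m<n∨m≡n rp≤k
      ... | inj₁ rp<k = ℕP.<-≤-trans (waiting-smaller c k rp<k k<ru) u≤v
      ... | inj₂ rp≡k = ℕP.≤∧≢⇒< (subst (λ y → toℕ y ≤ toℕ v) (sym vk≡p) p≤v)
                          (λ vk≡v → ℕP.<-irrefl (trans (sym (rank-vertexAt k)) (cong rank (FinP.toℕ-injective vk≡v))) k<rv)
        where
        vk≡p : vertexAt k ≡ lookup f c
        vk≡p = vertexAt-rank (lookup f c) k rp≡k

-- Priority-first search

adj-parent : ∀ {n} (f : ParentMap n) c → T (adj f (suc c) (lookup f c))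
adj-parent f c with lookup f c FinP.≟ lookup f c
... | yes _ = tt
... | no fc≢fc = contradiction refl fc≢fc

adj⇒parent-or-child : ∀ {n} (f : ParentMap n) {u w} → T (adj f u w) →
                      (∃ λ c → u ≡ suc c × lookup f c ≡ w) ⊎ (∃ λ c → w ≡ suc c × lookup f c ≡ u)
adj⇒parent-or-child f {zero} {suc j} fj≡0 = inj₂ (j , refl , to ==⇔≡ fj≡0)
adj⇒parent-or-child f {suc i} {w} adjacent with to T-∨ adjacent
... | inj₁ fi≡w = inj₁ (i , refl , to ==⇔≡ fi≡w)
adj⇒parent-or-child f {suc i} {suc j} _ | inj₂ fj≡i = inj₂ (j , refl , to ==⇔≡ fj≡i)

module PrioritySearch {n : ℕ} (f : ParentMap n) where
  open import Data.List.Membership.DecPropositional (FinP._≟_ {suc n}) using (_∈?_)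

  Vertex : Set
  Vertex = Fin (suc n)

  Waiting : List Vertex → Fin n → Set
  Waiting V c = suc c ∉ V × lookup f c ∈ V

  -- posOr V v = length V when v ∉ V, so waiting-smaller also covers vertices still waiting.
  record SearchPrefix (V : List Vertex) : Set where
    field
      unique          : Unique V
      root∈           : zero ∈ V
      parent-first    : ∀ c → suc c ∈ V → posOr V (lookup f c) < posOr V (suc c)
      waiting-smaller : ∀ c k → posOr V (lookup f c) < k → k < posOr V (suc c) →
                        toℕ (nthOr zero V k) < toℕ (suc c)

    parent-closed : ∀ c → suc c ∈ V → lookup f c ∈ V
    parent-closed c c∈V = posOr<length⇒∈ V (ℕP.<-trans (parent-first c c∈V) (posOr-∈ V c∈V))

  root-prefix : SearchPrefix [ zero ]
  root-prefix = record
    { unique = [] ∷ []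
    ; root∈ = here refl
    ; parent-first = λ { c (here ()) }
    ; waiting-smaller = λ c k parent<k k<child →
        contradiction (ℕP.<-≤-trans parent<k (ℕP.≤-pred (subst (k <_) (posOr-there {x = zero} {v = suc c} [] λ ()) k<child))) λ ()
    }

  module Extend {V : List Vertex} {c : Fin n} (P : SearchPrefix V) (waiting : Waiting V c)
                (c-least : ∀ d → Waiting V d → toℕ c ≤ toℕ d) where
    open SearchPrefix P
    private
      V′ : List Vertex
      V′ = V ++ [ suc c ]
      c∉V : suc c ∉ V
      c∉V = proj₁ waiting
      fc∈V : lookup f c ∈ V
      fc∈V = proj₂ waiting

      pos-old : ∀ {x} → x ∈ V → posOr V′ x ≡ posOr V x
      pos-old = posOr-++-∈ V [ suc c ]

      pos-new : posOr V′ (suc c) ≡ length V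
      pos-new = posOr-snoc-new V c∉V

      pos-≤ : ∀ x → posOr V′ x ≤ suc (length V)
      pos-≤ x = posOr-snoc-≤ x V (suc c)

    unique′ : Unique V′
    unique′ = UniqueP.++⁺ unique ([] ∷ []) λ { (c∈V , here refl) → c∉V c∈V }

    parent-first′ : ∀ d → suc d ∈ V′ → posOr V′ (lookup f d) < posOr V′ (suc d)
    parent-first′ d d∈V′ with ∈-++⁻ V d∈V′
    ... | inj₁ d∈V = subst₂ _<_ (sym (pos-old (parent-closed d d∈V))) (sym (pos-old d∈V)) (parent-first d d∈V)
    ... | inj₂ (here refl) = subst₂ _<_ (sym (pos-old fc∈V)) (sym pos-new) (posOr-∈ V fc∈V)

    new-vertex-smaller : ∀ d → lookup f d ∈ V → length V < posOr V′ (suc d) → toℕ (suc c) < toℕ (suc d)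
    new-vertex-smaller d fd∈V |V|<child = s≤s (ℕP.≤∧≢⇒< (c-least d (d∉V , fd∈V)) (d≢c ∘ sym ∘ FinP.toℕ-injective))
      where
      d∉V : suc d ∉ V
      d∉V d∈V = ℕP.<-asym |V|<child (subst (_< length V) (sym (pos-old d∈V)) (posOr-∈ V d∈V))
      d≢c : d ≢ c
      d≢c refl = ℕP.<-irrefl (sym pos-new) |V|<child

    waiting-smaller′ : ∀ d k → posOr V′ (lookup f d) < k → k < posOr V′ (suc d) →
                       toℕ (nthOr zero V′ k) < toℕ (suc d)
    waiting-smaller′ d k parent<k k<child with lookup f d ∈? V
    ... | no fd∉V = contradiction (ℕP.≤-pred (ℕP.<-≤-trans k<child (pos-≤ (suc d))))
                                  (ℕP.<⇒≱ (ℕP.≤-<-trans (posOr-snoc-∉ V (suc c) fd∉V) parent<k))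
    ... | yes fd∈V with ℕP.<-cmp k (length V)
    ...   | tri< k<|V| _ _ = subst (λ x → toℕ x < toℕ (suc d)) (sym (nthOr-++ˡ zero V [ suc c ] k<|V|))
                               (waiting-smaller d k (subst (_< k) (pos-old fd∈V) parent<k) k<child-in-V)
      where
      k<child-in-V : k < posOr V (suc d)
      k<child-in-V with suc d ∈? V
      ... | yes d∈V = subst (k <_) (pos-old d∈V) k<child
      ... | no d∉V = subst (k <_) (sym (posOr-∉ V d∉V)) k<|V|
    ...   | tri≈ _ refl _ = subst (λ x → toℕ x < toℕ (suc d)) (sym (nthOr-snoc-new zero V (suc c)))
                              (new-vertex-smaller d fd∈V k<child)
    ...   | tri> _ _ |V|<k = contradiction (ℕP.≤-pred (ℕP.<-≤-trans k<child (pos-≤ (suc d)))) (ℕP.<⇒≱ |V|<k)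

    extend : SearchPrefix V′
    extend = record { unique = unique′ ; root∈ = ∈-++⁺ˡ root∈ ; parent-first = parent-first′ ; waiting-smaller = waiting-smaller′ }

  Visited : Vec Bool (suc n) → List Vertex → Set
  Visited vis V = ∀ u → T (lookup vis u) ⇔ u ∈ V

  root-visited : Visited (true ∷ replicate n false) [ zero ]
  root-visited zero = mk⇔ (λ _ → here refl) (λ _ → tt)
  root-visited (suc i) = mk⇔ (λ visited → contradiction (subst T (VecP.lookup-replicate i false) visited) λ ())
                             (λ { (here ()) })

  visit : ∀ {vis V} u → Visited vis V → Visited (vis [ u ]≔ true) (V ++ [ u ])
  visit {vis} {V} u visited w = mk⇔ visited⇒∈ ∈⇒visited
    where
    visited⇒∈ : T (lookup (vis [ u ]≔ true) w) → w ∈ V ++ [ u ]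
    visited⇒∈ w-visited with to (lookup-set-true vis u w) w-visited
    ... | inj₁ refl = ∈-++⁺ʳ V (here refl)
    ... | inj₂ w-visited-before = ∈-++⁺ˡ (to (visited w) w-visited-before)
    ∈⇒visited : w ∈ V ++ [ u ] → T (lookup (vis [ u ]≔ true) w)
    ∈⇒visited w∈ with ∈-++⁻ V w∈
    ... | inj₁ w∈V = from (lookup-set-true vis u w) (inj₂ (from (visited w) w∈V))
    ... | inj₂ (here refl) = from (lookup-set-true vis u w) (inj₁ refl)

  frontierᵇ : Vec Bool (suc n) → Vertex → Bool
  frontierᵇ vis u = not (lookup vis u) ∧ any (λ w → lookup vis w ∧ adj f u w) (allFin (suc n))

  frontier⇔waiting : ∀ {vis V} → Visited vis V → SearchPrefix V → ∀ u →
                     T (frontierᵇ vis u) ⇔ (∃ λ c → u ≡ suc c × Waiting V c)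
  frontier⇔waiting {vis} {V} visited P u = mk⇔ frontier⇒waiting waiting⇒frontier
    where
    open SearchPrefix P
    unvisited⇒∉ : T (not (lookup vis u)) → u ∉ V
    unvisited⇒∉ unvisited = to T-not⇔¬T unvisited ∘ from (visited u)
    frontier⇒waiting : T (frontierᵇ vis u) → ∃ λ c → u ≡ suc c × Waiting V c
    frontier⇒waiting frontier
      with unvisited , has-visited-neighbour ← to T-∧ frontier
      with w , w-visited∧adjacent ← to (any-allFin⇔ _) has-visited-neighbour
      with w-visited , adjacent ← to T-∧ w-visited∧adjacent
      with adj⇒parent-or-child f {u} {w} adjacent
    ... | inj₁ (c , refl , fc≡w) = c , refl , unvisited⇒∉ unvisited , subst (_∈ V) (sym fc≡w) (to (visited w) w-visited)
    ... | inj₂ (c , refl , fc≡u) = contradiction (subst (_∈ V) fc≡u (parent-closed c (to (visited w) w-visited)))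
                                                 (unvisited⇒∉ unvisited)
    waiting⇒frontier : (∃ λ c → u ≡ suc c × Waiting V c) → T (frontierᵇ vis u)
    waiting⇒frontier (c , refl , c∉V , fc∈V) =
      from T-∧ ( from T-not⇔¬T (c∉V ∘ to (visited u))
               , from (any-allFin⇔ _) (lookup f c , from T-∧ (from (visited _) fc∈V , adj-parent f c)))

  module _ (reaches-root : ∀ v → iter n (up f) v ≡ zero) where

    waiting-exists : ∀ {V} → SearchPrefix V → length V < suc n → ∃ (Waiting V)
    waiting-exists {V} P |V|<
      with u , u∉V ← unique-length<⇒missing (SearchPrefix.unique P) |V|<
      = leave n u u∉V (subst (_∈ V) (sym (reaches-root u)) (SearchPrefix.root∈ P))
      where
      exit : ∀ w → w ∉ V → up f w ∈ V → ∃ (Waiting V)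
      exit zero w∉V _ = contradiction (SearchPrefix.root∈ P) w∉V
      exit (suc c) c∉V fc∈V = c , c∉V , fc∈V
      leave : ∀ m x → x ∉ V → iter m (up f) x ∈ V → ∃ (Waiting V)
      leave zero x x∉V x∈V = contradiction x∈V x∉V
      leave (suc m) x x∉V up∈V with iter m (up f) x ∈? V
      ... | yes ∈V = leave m x x∉V ∈V
      ... | no ∉V = exit (iter m (up f) x) ∉V up∈V

    search : ∀ fuel {V vis} → Visited vis V → SearchPrefix V → length V + fuel ≡ suc n →
             SearchPrefix (V ++ pfs f fuel vis) × length (V ++ pfs f fuel vis) ≡ suc n
    search zero {V} _ P |V|≡ = subst (λ W → SearchPrefix W × length W ≡ suc n) (sym (ListP.++-identityʳ V))
                                     (P , trans (sym (ℕP.+-identityʳ _)) |V|≡)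
    search (suc fuel) {V} {vis} visited P |V|≡ with head (filterᵇ (frontierᵇ vis) (allFin (suc n))) in next
    ... | nothing with c , waiting ← waiting-exists P (subst (length V <_) |V|≡ (ℕP.m<m+n (length V) (s≤s z≤n)))
      = contradiction (from (frontier⇔waiting {vis} visited P (suc c)) (c , refl , waiting))
                      (head-filterᵇ-nothing (frontierᵇ vis) id next (suc c))
    ... | just u with _ , refl , u-first ← head-filterᵇ-just⁻ (frontierᵇ vis) id next
                 with c , refl , waiting ← to (frontier⇔waiting {vis} visited P u) (proj₁ u-first)
      = subst (λ W → SearchPrefix W × length W ≡ suc n) (ListP.++-assoc V [ suc c ] _)
          (search fuel (visit {vis} (suc c) visited) (Extend.extend P waiting c-least)
                  (trans (cong (_+ fuel) (ListP.length-++ V)) (trans (ℕP.+-assoc (length V) 1 fuel) |V|≡)))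
      where
      c-least : ∀ d → Waiting V d → toℕ c ≤ toℕ d
      c-least d d-waiting = ℕP.≮⇒≥ λ d<c →
        proj₂ u-first (suc d) (s≤s d<c) (from (frontier⇔waiting {vis} visited P (suc d)) (d , refl , d-waiting))

    visitOrder-isPriorityOrder : IsPriorityOrder f (ωT⁻¹ f) (ωT f)
    visitOrder-isPriorityOrder = record
      { rank-vertexAt = λ k → posOr-nthOr zero L unique (subst (toℕ k <_) (sym |L|≡) (FinP.toℕ<n k))
      ; vertexAt-rank = λ v k rv≡k → trans (cong (nthOr zero L) (sym rv≡k)) (nthOr-posOr zero L (complete v))
      ; rank< = λ v → subst (posOr L v <_) |L|≡ (posOr-∈ L (complete v))
      ; parent-first = λ c → parent-first c (complete (suc c))
      ; waiting-smaller = λ c k → waiting-smaller c (toℕ k)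
      }
      where
      L : List Vertex
      L = visitOrder f
      L-prefix : SearchPrefix L × length L ≡ suc n
      L-prefix = search n root-visited root-prefix refl
      open SearchPrefix (proj₁ L-prefix)
      |L|≡ : length L ≡ suc n
      |L|≡ = proj₂ L-prefix
      complete : ∀ v → v ∈ L
      complete = unique-length≡⇒complete unique |L|≡

iter-root : ∀ {n} (f : ParentMap n) m → iter m (up f) zero ≡ zero
iter-root f zero = refl
iter-root f (suc m) = cong (up f) (iter-root f m)

isTree⇒isPriorityOrder : ∀ {n} {f : ParentMap n} → T (isTree f) → IsPriorityOrder f (ωT⁻¹ f) (ωT f)
isTree⇒isPriorityOrder {n} {f} tree = PrioritySearch.visitOrder-isPriorityOrder f reaches-root
  where
  reaches-root : ∀ v → iter n (up f) v ≡ zero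
  reaches-root zero = iter-root f n
  reaches-root (suc i) = to ==⇔≡ (to (all-allFin⇔ _) tree i)

-- Parking

module _ {n : ℕ} where

  IsFirstFree : Vec Bool n → Fin n → Fin n → Set
  IsFirstFree occ p j = toℕ p ≤ toℕ j × ¬ T (lookup occ j) × (∀ j′ → toℕ p ≤ toℕ j′ → toℕ j′ < toℕ j → T (lookup occ j′))

  firstFree⇔ : ∀ occ p j → firstFree occ p ≡ just j ⇔ IsFirstFree occ p j
  firstFree⇔ occ p j = mk⇔ just⇒first-free first-free⇒just
    where
    free-from-p : Fin n → Bool
    free-from-p j = (toℕ p ≤ᵇ toℕ j) ∧ not (lookup occ j)
    just⇒first-free : firstFree occ p ≡ just j → IsFirstFree occ p j
    just⇒first-free eq with _ , refl , j-free , before-j ← head-filterᵇ-just⁻ free-from-p id eq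
      with p≤j , j-unoccupied ← to T-∧ j-free
      = to ≤ᵇ⇔≤ p≤j , to T-not⇔¬T j-unoccupied , occupied
      where
      occupied : ∀ j′ → toℕ p ≤ toℕ j′ → toℕ j′ < toℕ j → T (lookup occ j′)
      occupied j′ p≤j′ j′<j with T? (lookup occ j′)
      ... | yes j′-occupied = j′-occupied
      ... | no j′-free = contradiction (from T-∧ (from ≤ᵇ⇔≤ p≤j′ , from T-not⇔¬T j′-free)) (before-j j′ j′<j)
    first-free⇒just : IsFirstFree occ p j → firstFree occ p ≡ just j
    first-free⇒just (p≤j , j-free , occupied) = head-filterᵇ-just⁺ free-from-p id
      ( from T-∧ (from ≤ᵇ⇔≤ p≤j , from T-not⇔¬T j-free)
      , λ j′ j′<j j′-free → to T-not⇔¬T (proj₂ (to T-∧ j′-free)) (occupied j′ (to ≤ᵇ⇔≤ (proj₁ (to T-∧ j′-free))) j′<j))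

  record Parks {k : ℕ} (occ : Vec Bool n) (ps ss : Vec (Fin n) k) : Set where
    field
      pref≤spot       : ∀ c → toℕ (lookup ps c) ≤ toℕ (lookup ss c)
      spot-free       : ∀ c → ¬ T (lookup occ (lookup ss c))
      spots-injective : ∀ {c d} → lookup ss c ≡ lookup ss d → c ≡ d
      passed-taken    : ∀ c j → toℕ (lookup ps c) ≤ toℕ j → toℕ j < toℕ (lookup ss c) →
                        T (lookup occ j) ⊎ ∃ λ d → toℕ d < toℕ c × lookup ss d ≡ j

  module _ {k : ℕ} {occ : Vec Bool n} {p j : Fin n} {ps js : Vec (Fin n) k} where

    Parks-∷⁻ : Parks occ (p ∷ ps) (j ∷ js) → IsFirstFree occ p j × Parks (occ [ j ]≔ true) ps js
    Parks-∷⁻ parks = (pref≤spot zero , spot-free zero , first-passed-taken) , record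
      { pref≤spot = pref≤spot ∘ suc
      ; spot-free = λ c → [ j≢js c ∘ sym , spot-free (suc c) ]′ ∘ to (lookup-set-true occ j (lookup js c))
      ; spots-injective = FinP.suc-injective ∘ spots-injective
      ; passed-taken = λ c j′ p≤j′ j′<s → rest-passed-taken c j′ (passed-taken (suc c) j′ p≤j′ j′<s)
      }
      where
      open Parks parks
      j≢js : ∀ c → lookup js c ≢ j
      j≢js c js≡j = contradiction (spots-injective {suc c} {zero} js≡j) λ ()
      first-passed-taken : ∀ j′ → toℕ p ≤ toℕ j′ → toℕ j′ < toℕ j → T (lookup occ j′)
      first-passed-taken j′ p≤j′ j′<j with passed-taken zero j′ p≤j′ j′<j
      ... | inj₁ j′-occupied = j′-occupied
      rest-passed-taken : ∀ c j′ → T (lookup occ j′) ⊎ (∃ λ d → toℕ d < suc (toℕ c) × lookup (j ∷ js) d ≡ j′) →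
                          T (lookup (occ [ j ]≔ true) j′) ⊎ ∃ λ d → toℕ d < toℕ c × lookup js d ≡ j′
      rest-passed-taken c j′ (inj₁ j′-occupied) = inj₁ (from (lookup-set-true occ j j′) (inj₂ j′-occupied))
      rest-passed-taken c j′ (inj₂ (zero , _ , j≡j′)) = inj₁ (from (lookup-set-true occ j j′) (inj₁ j≡j′))
      rest-passed-taken c j′ (inj₂ (suc d , d<c , js≡j′)) = inj₂ (d , ℕP.≤-pred d<c , js≡j′)

    Parks-∷⁺ : IsFirstFree occ p j → Parks (occ [ j ]≔ true) ps js → Parks occ (p ∷ ps) (j ∷ js)
    Parks-∷⁺ (p≤j , j-free , occupied) parks = record
      { pref≤spot = λ { zero → p≤j ; (suc c) → pref≤spot c }
      ; spot-free = λ { zero → j-free ; (suc c) → spot-free c ∘ from (lookup-set-true occ j _) ∘ inj₂ }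
      ; spots-injective = injective
      ; passed-taken = λ { zero j′ p≤j′ j′<j → inj₁ (occupied j′ p≤j′ j′<j)
                         ; (suc c) j′ p≤j′ j′<s → shift (passed-taken c j′ p≤j′ j′<s) }
      }
      where
      open Parks parks
      j≢js : ∀ c → j ≢ lookup js c
      j≢js c j≡js = spot-free c (from (lookup-set-true occ j _) (inj₁ j≡js))
      injective : ∀ {c d} → lookup (j ∷ js) c ≡ lookup (j ∷ js) d → c ≡ d
      injective {zero} {zero} _ = refl
      injective {zero} {suc d} j≡js = contradiction j≡js (j≢js d)
      injective {suc c} {zero} js≡j = contradiction (sym js≡j) (j≢js c)
      injective {suc c} {suc d} js≡js = cong suc (spots-injective js≡js)
      shift : ∀ {c j′} → T (lookup (occ [ j ]≔ true) j′) ⊎ (∃ λ d → toℕ d < toℕ c × lookup js d ≡ j′) →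
              T (lookup occ j′) ⊎ ∃ λ d → toℕ d < suc (toℕ c) × lookup (j ∷ js) d ≡ j′
      shift {j′ = j′} (inj₁ j′-occupied) with to (lookup-set-true occ j j′) j′-occupied
      ... | inj₁ j≡j′ = inj₂ (zero , s≤s z≤n , j≡j′)
      ... | inj₂ j′-occupied-before = inj₁ j′-occupied-before
      shift (inj₂ (d , d<c , js≡j′)) = inj₂ (suc d , s≤s d<c , js≡j′)

  runParking⇒Parks : ∀ {k} {occ : Vec Bool n} (ps ss : Vec (Fin n) k) → runParking occ ps ≡ just ss → Parks occ ps ss
  runParking⇒Parks [] [] _ = record { pref≤spot = λ () ; spot-free = λ () ; spots-injective = λ { {()} } ; passed-taken = λ () }
  runParking⇒Parks {occ = occ} (p ∷ ps) ss eq with firstFree occ p in first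
  ... | just j with runParking (occ [ j ]≔ true) ps in rest
  ...   | just js with refl ← eq = Parks-∷⁺ (to (firstFree⇔ occ p j) first) (runParking⇒Parks ps js rest)

  Parks⇒runParking : ∀ {k} {occ : Vec Bool n} (ps ss : Vec (Fin n) k) → Parks occ ps ss → runParking occ ps ≡ just ss
  Parks⇒runParking [] [] _ = refl
  Parks⇒runParking {occ = occ} (p ∷ ps) (j ∷ js) parks
    with first-free , rest ← Parks-∷⁻ parks
    rewrite from (firstFree⇔ occ p j) first-free | Parks⇒runParking ps js rest = refl

empty-street : ∀ {n} (j : Fin n) → ¬ T (lookup (replicate n false) j)
empty-street j = subst T (VecP.lookup-replicate j false)

module _ {n : ℕ} (a : Prefs n) where

  parkingFunction⇒Parks : T (isParkingFunction a) → Parks (replicate n false) a (spots a)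
  parkingFunction⇒Parks _ with runParking (replicate n false) a in run
  ... | just ss = runParking⇒Parks a ss run

  Parks⇒parkingFunction : ∀ {ss} → Parks (replicate n false) a ss → T (isParkingFunction a) × spots a ≡ ss
  Parks⇒parkingFunction parks rewrite Parks⇒runParking a _ parks = tt , refl

  ωπ-spots : (∀ {c d} → lookup (spots a) c ≡ lookup (spots a) d → c ≡ d) → ∀ c → ωπ a (lookup (spots a) c) ≡ c
  ωπ-spots spots-injective c = cong (fromMaybe _) (head-filterᵇ-just⁺ (λ d → lookup (spots a) d == lookup (spots a) c) id
    (from ==⇔≡ refl , λ d d<c same-spot → ℕP.<-irrefl (cong toℕ (spots-injective (to ==⇔≡ same-spot))) d<c))

  spots-ωπ : (∀ {c d} → lookup (spots a) c ≡ lookup (spots a) d → c ≡ d) → ∀ j → lookup (spots a) (ωπ a j) ≡ j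
  spots-ωπ spots-injective j with c , refl ← injective⇒surjective (lookup (spots a)) spots-injective j =
    cong (lookup (spots a)) (ωπ-spots spots-injective c)

-- Trees and parking functions in correspondence

-- fromℕ< with a junk fallback: the bound holds for the arguments used below only for trees.
clamp : ∀ {m} → ℕ → Fin m → Fin m
clamp {m} k fallback with k <? m
... | yes k<m = fromℕ< k<m
... | no _ = fallback

toℕ-clamp : ∀ {m} k (fallback : Fin m) → k < m → toℕ (clamp k fallback) ≡ k
toℕ-clamp {m} k fallback k<m with k <? m
... | yes k<m = FinP.toℕ-fromℕ< k<m
... | no k≮m = contradiction k<m k≮m

module _ {n : ℕ} where

  parkingOf : ParentMap n → Prefs n
  parkingOf f = tabulate λ c → clamp (ωT⁻¹ f (lookup f c)) c

  vertexAtπ : Prefs n → Fin (suc n) → Fin (suc n)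
  vertexAtπ a zero = zero
  vertexAtπ a (suc j) = suc (ωπ a j)

  treeOf : Prefs n → ParentMap n
  treeOf a = Vec.map (vertexAtπ a ∘ inject₁) a

  -- Car c is vertex suc c.  Spots are 0-based whereas visiting time 0 belongs to the root,
  -- which explains the suc in 1+spot≡rank.
  record Corresponds (f : ParentMap n) (a : Prefs n) : Set where
    field
      tree              : T (isTree f)
      parkingFunction   : T (isParkingFunction a)
      pref≡rank-parent  : ∀ c → toℕ (lookup a c) ≡ ωT⁻¹ f (lookup f c)
      1+spot≡rank       : ∀ c → suc (toℕ (lookup (spots a) c)) ≡ ωT⁻¹ f (suc c)

module Correspondence {n : ℕ} {f : ParentMap n} {a : Prefs n} (corr : Corresponds f a) where
  open Corresponds corr
  po : IsPriorityOrder f (ωT⁻¹ f) (ωT f)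
  po = isTree⇒isPriorityOrder tree
  open PriorityOrder po

  private
    ρ : Fin (suc n) → ℕ
    ρ = ωT⁻¹ f
    σ : Fin (suc n) → Fin (suc n)
    σ = ωT f
    s : Fin n → Fin n
    s = lookup (spots a)
    ω : Fin n → Fin n
    ω = ωπ a

  spots-injective : ∀ {c d} → s c ≡ s d → c ≡ d
  spots-injective {c} {d} sc≡sd = FinP.suc-injective (rank-injective (begin
    ρ (suc c)       ≡⟨ 1+spot≡rank c ⟨
    suc (toℕ (s c)) ≡⟨ cong (suc ∘ toℕ) sc≡sd ⟩
    suc (toℕ (s d)) ≡⟨ 1+spot≡rank d ⟩
    ρ (suc d)       ∎))
    where open ≡-Reasoning

  ω-spot : ∀ c → ω (s c) ≡ c
  ω-spot = ωπ-spots a spots-injective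

  vertexAt-spot : ∀ c → σ (suc (s c)) ≡ suc c
  vertexAt-spot c = vertexAt-rank (suc c) (suc (s c)) (sym (1+spot≡rank c))

  vertexAt≡vertexAtπ : ∀ k → σ k ≡ vertexAtπ a k
  vertexAt≡vertexAtπ zero = vertexAt-zero
  vertexAt≡vertexAtπ (suc j) with c , refl ← injective⇒surjective s spots-injective j =
    trans (vertexAt-spot c) (cong suc (sym (ω-spot c)))

  pref≤spot : ∀ c → toℕ (lookup a c) ≤ toℕ (s c)
  pref≤spot c = ℕP.≤-pred (subst₂ _<_ (sym (pref≡rank-parent c)) (sym (1+spot≡rank c)) (parent-first c))

  ptParent-spot : ∀ c → ptParent f (s c) ≡ toℕ (lookup a c)
  ptParent-spot c = trans (cong (ρ ∘ up f) (vertexAt-spot c)) (sym (pref≡rank-parent c))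

  probes≡wait : probes a ≡ wait f
  probes≡wait = begin
    dis a + n                                        ≡⟨ ℕP.+-comm (dis a) n ⟩
    n + dis a                                        ≡⟨ cong (_+ dis a) (ListP.length-tabulate id) ⟨
    length (allFin n) + sum (map displacement (allFin n)) ≡⟨ sum-map-suc displacement (allFin n) ⟨
    sum (map (λ c → suc (displacement c)) (allFin n)) ≡⟨ cong sum (ListP.map-cong waiting-time (allFin n)) ⟩
    sum (map (wait-term ∘ s) (allFin n))             ≡⟨ sum-permute s spots-injective wait-term ⟩
    wait f                                           ∎
    where
    open ≡-Reasoning
    displacement : Fin n → ℕ
    displacement c = toℕ (s c) ∸ toℕ (lookup a c)
    wait-term : Fin n → ℕ
    wait-term i = suc (toℕ i) ∸ ptParent f i
    waiting-time : ∀ c → suc (displacement c) ≡ wait-term (s c)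
    waiting-time c = trans (sym (ℕP.+-∸-assoc 1 (pref≤spot c))) (cong (suc (toℕ (s c)) ∸_) (sym (ptParent-spot c)))

  lucky≡psa : lucky a ≡ psa f
  lucky≡psa = trans (countᵇ-cong (allFin n) λ {c} _ → mk⇔ (lucky⇒ c) (⇒lucky c))
                    (countᵇ-permute s spots-injective (λ i → ptParent f i ≡ᵇ toℕ i))
    where
    lucky⇒ : ∀ c → T (s c == lookup a c) → T (ptParent f (s c) ≡ᵇ toℕ (s c))
    lucky⇒ c sc≡ac = from ≡ᵇ⇔≡ (trans (ptParent-spot c) (cong toℕ (sym (to ==⇔≡ sc≡ac))))
    ⇒lucky : ∀ c → T (ptParent f (s c) ≡ᵇ toℕ (s c)) → T (s c == lookup a c)
    ⇒lucky c parent≡ = from ==⇔≡ (FinP.toℕ-injective (sym (trans (sym (ptParent-spot c)) (to ≡ᵇ⇔≡ parent≡))))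

  ones≡degRoot : ones a ≡ degRoot f
  ones≡degRoot = countᵇ-cong (allFin n) λ {c} _ → mk⇔
    (λ ac≡0 → from ==⇔≡ (rank≡0⇒root (trans (sym (pref≡rank-parent c)) (to ≡ᵇ⇔≡ ac≡0))))
    (λ fc≡0 → from ≡ᵇ⇔≡ (trans (pref≡rank-parent c) (trans (cong ρ (to ==⇔≡ fc≡0)) rank-root)))

  occurrences≡children : ∀ x → occurrences a x ≡ children f (σ x)
  occurrences≡children x = countᵇ-cong (allFin n) λ {c} _ → mk⇔
    (λ ac≡x → from ==⇔≡ (sym (vertexAt-rank (lookup f c) x (trans (sym (pref≡rank-parent c)) (to ≡ᵇ⇔≡ ac≡x)))))
    (λ fc≡σx → from ≡ᵇ⇔≡ (trans (pref≡rank-parent c) (trans (cong ρ (to ==⇔≡ fc≡σx)) (rank-vertexAt x))))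

  mult≡chseq : mult a ≡ chseq f
  mult≡chseq = VecP.tabulate-cong λ i → trans
    (countᵇ-cong (allFin (suc n)) λ {x} _ → T-cong (cong (_≡ᵇ toℕ i) (occurrences≡children x)))
    (countᵇ-permute σ vertexAt-injective (λ v → children f v ≡ᵇ toℕ i))

  RecP-entry⇔ : ∀ i → T (lookup (RecP a) i) ⇔ (∀ j → toℕ j < toℕ (s i) → toℕ (ω j) < toℕ i)
  RecP-entry⇔ i = ⇔.trans (T-cong (VecP.lookup∘tabulate _ i)) (mk⇔ record⇒prefix-max prefix-max⇒record)
    where
    _⇒ᵇ_ : Bool → Bool → Bool
    x ⇒ᵇ y = not x ∨ y
    prefix-maxᵇ : Fin n → Bool
    prefix-maxᵇ j = all (λ k → (toℕ k <ᵇ toℕ j) ⇒ᵇ (toℕ (ω k) <ᵇ toℕ i)) (allFin n)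
    record⇒prefix-max : T (any (λ j → (ω j == i) ∧ prefix-maxᵇ j) (allFin n)) →
                        ∀ j → toℕ j < toℕ (s i) → toℕ (ω j) < toℕ i
    record⇒prefix-max is-record k k<si
      with j , ωj≡i∧max ← to (any-allFin⇔ _) is-record
      with ωj≡i , max ← to T-∧ ωj≡i∧max
      with to T-∨ (to (all-allFin⇔ _) max k)
    ... | inj₁ k≮j = contradiction (from <ᵇ⇔< (subst (λ x → toℕ k < toℕ x) si≡j k<si)) (to T-not⇔¬T k≮j)
      where
      si≡j : s i ≡ j
      si≡j = trans (cong s (sym (to (==⇔≡ {i = ω j}) ωj≡i))) (spots-ωπ a spots-injective j)
    ... | inj₂ ωk<ωj = to <ᵇ⇔< ωk<ωj
    prefix-max⇒record : (∀ j → toℕ j < toℕ (s i) → toℕ (ω j) < toℕ i) →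
                        T (any (λ j → (ω j == i) ∧ prefix-maxᵇ j) (allFin n))
    prefix-max⇒record max = from (any-allFin⇔ _) (s i , from T-∧ (from ==⇔≡ (ω-spot i) , from (all-allFin⇔ _) max-at-spot))
      where
      max-at-spot : ∀ k → T ((toℕ k <ᵇ toℕ (s i)) ⇒ᵇ (toℕ (ω k) <ᵇ toℕ i))
      max-at-spot k with toℕ k ℕP.<? toℕ (s i)
      ... | yes k<si = from T-∨ (inj₂ (from <ᵇ⇔< (max k k<si)))
      ... | no k≮si = from T-∨ (inj₁ (from T-not⇔¬T (k≮si ∘ to <ᵇ⇔<)))

  prefix-max⇔earlier-< : ∀ i → (∀ j → toℕ j < toℕ (s i) → toℕ (ω j) < toℕ i) ⇔
                               (∀ k → toℕ k < ρ (suc i) → toℕ (σ k) < toℕ (suc i))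
  prefix-max⇔earlier-< i = mk⇔ prefix-max⇒earlier earlier⇒prefix-max
    where
    prefix-max⇒earlier : (∀ j → toℕ j < toℕ (s i) → toℕ (ω j) < toℕ i) → ∀ k → toℕ k < ρ (suc i) → toℕ (σ k) < toℕ (suc i)
    prefix-max⇒earlier max zero _ = subst (λ x → toℕ x < suc (toℕ i)) (sym vertexAt-zero) (s≤s z≤n)
    prefix-max⇒earlier max (suc j) 1+j<ρ = subst (λ x → toℕ x < suc (toℕ i)) (sym (vertexAt≡vertexAtπ (suc j)))
      (s≤s (max j (ℕP.≤-pred (subst (suc (toℕ j) <_) (sym (1+spot≡rank i)) 1+j<ρ))))
    earlier⇒prefix-max : (∀ k → toℕ k < ρ (suc i) → toℕ (σ k) < toℕ (suc i)) → ∀ j → toℕ j < toℕ (s i) → toℕ (ω j) < toℕ i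
    earlier⇒prefix-max earlier j j<si = ℕP.≤-pred (subst (λ x → toℕ x < suc (toℕ i)) (vertexAt≡vertexAtπ (suc j))
      (earlier (suc j) (subst (suc (toℕ j) <_) (1+spot≡rank i) (s≤s j<si))))

  RecT-entry⇔ : ∀ i → T (lookup (RecT f) i) ⇔ (∀ (m : Fin (suc n)) → toℕ (iter (toℕ m) (up f) (suc i)) ≤ toℕ (suc i))
  RecT-entry⇔ i = ⇔.trans (T-cong (VecP.lookup∘tabulate _ i))
                   (mk⇔ (λ all≤ m → to ≤ᵇ⇔≤ (to (all-allFin⇔ _) all≤ m)) (λ ≤-all → from (all-allFin⇔ _) (from ≤ᵇ⇔≤ ∘ ≤-all)))

  RecP≡RecT : RecP a ≡ RecT f
  RecP≡RecT = Vec-ext λ i → T-injective (⇔.trans (RecP-entry⇔ i) (⇔.trans (prefix-max⇔earlier-< i)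
                (⇔.trans (⇔.sym (ancestors-≤⇔earlier-< po (suc i))) (⇔.sym (RecT-entry⇔ i)))))

  hexadP≡hexadT : hexadP a ≡ hexadT f
  hexadP≡hexadT = cong₂ _,_ RecP≡RecT (cong₂ _,_ probes≡wait (cong₂ _,_ lucky≡psa
                    (cong₂ _,_ ones≡degRoot (cong₂ _,_ mult≡chseq refl))))

  parkingOf≡ : parkingOf f ≡ a
  parkingOf≡ = Vec-ext λ c → FinP.toℕ-injective (begin
    toℕ (lookup (parkingOf f) c)        ≡⟨ cong toℕ (VecP.lookup∘tabulate _ c) ⟩
    toℕ (clamp (ρ (lookup f c)) c)      ≡⟨ toℕ-clamp _ c (subst (_< n) (pref≡rank-parent c) (FinP.toℕ<n (lookup a c))) ⟩
    ρ (lookup f c)                      ≡⟨ pref≡rank-parent c ⟨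
    toℕ (lookup a c)                    ∎)
    where open ≡-Reasoning

  treeOf≡ : treeOf a ≡ f
  treeOf≡ = Vec-ext λ c → begin
    lookup (treeOf a) c                 ≡⟨ VecP.lookup-map c _ a ⟩
    vertexAtπ a (inject₁ (lookup a c))  ≡⟨ vertexAt≡vertexAtπ _ ⟨
    σ (inject₁ (lookup a c))            ≡⟨ vertexAt-rank (lookup f c) _ (trans (sym (pref≡rank-parent c)) (sym (FinP.toℕ-inject₁ _))) ⟩
    lookup f c                          ∎
    where open ≡-Reasoning

module _ {n : ℕ} {f : ParentMap n} (tree : T (isTree f)) where
  open PriorityOrder (isTree⇒isPriorityOrder {f = f} tree)

  private
    ρ : Fin (suc n) → ℕ
    ρ = ωT⁻¹ f
    σ : Fin (suc n) → Fin (suc n)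
    σ = ωT f

  rank-child≢0 : ∀ c → ρ (suc c) ≢ 0
  rank-child≢0 c ρ≡0 = contradiction (rank≡0⇒root {suc c} ρ≡0) λ ()

  spotOf : Fin n → Fin n
  spotOf c = clamp (ρ (suc c) ∸ 1) c

  1+spotOf : ∀ c → suc (toℕ (spotOf c)) ≡ ρ (suc c)
  1+spotOf c = begin
    suc (toℕ (spotOf c))  ≡⟨ cong suc (toℕ-clamp _ c (subst (_≤ n) (sym 1+pred≡) (ℕP.≤-pred (rank< (suc c))))) ⟩
    suc (ρ (suc c) ∸ 1)   ≡⟨ 1+pred≡ ⟩
    ρ (suc c)             ∎
    where
    open ≡-Reasoning
    1+pred≡ : suc (ρ (suc c) ∸ 1) ≡ ρ (suc c)
    1+pred≡ = ℕP.suc-pred (ρ (suc c)) {{≢-nonZero (rank-child≢0 c)}}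

  toℕ-parkingOf : ∀ c → toℕ (lookup (parkingOf f) c) ≡ ρ (lookup f c)
  toℕ-parkingOf c = trans (cong toℕ (VecP.lookup∘tabulate _ c))
    (toℕ-clamp _ c (ℕP.<-≤-trans (parent-first c) (ℕP.≤-pred (rank< (suc c)))))

  spotOf-injective : ∀ {c d} → spotOf c ≡ spotOf d → c ≡ d
  spotOf-injective {c} {d} eq =
    FinP.suc-injective (rank-injective (trans (sym (1+spotOf c)) (trans (cong (suc ∘ toℕ) eq) (1+spotOf d))))

  passed-spot-taken : ∀ c j → toℕ (lookup (parkingOf f) c) ≤ toℕ j → toℕ j < toℕ (spotOf c) →
                      ∃ λ d → toℕ d < toℕ c × spotOf d ≡ j
  passed-spot-taken c j pref≤j j<spot with σ (suc j) in σ≡ | rank-vertexAt (suc j)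
  ... | zero | ρ0≡ = contradiction (trans (sym rank-root) ρ0≡) λ ()
  ... | suc d | ρd≡ = d , ℕP.≤-pred d<c , FinP.toℕ-injective (ℕP.suc-injective (trans (1+spotOf d) ρd≡))
    where
    d<c : suc (toℕ d) < suc (toℕ c)
    d<c = subst (λ x → toℕ x < suc (toℕ c)) σ≡ (waiting-smaller c (suc j)
            (s≤s (subst (_≤ toℕ j) (toℕ-parkingOf c) pref≤j))
            (subst (suc (toℕ j) <_) (1+spotOf c) (s≤s j<spot)))

  parks : Parks (replicate n false) (parkingOf f) (tabulate spotOf)
  parks = record
    { pref≤spot = λ c → subst₂ _≤_ (sym (toℕ-parkingOf c)) (cong toℕ (sym (VecP.lookup∘tabulate spotOf c)))
                          (ℕP.≤-pred (subst (ρ (lookup f c) <_) (sym (1+spotOf c)) (parent-first c)))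
    ; spot-free = λ c → empty-street (lookup (tabulate spotOf) c)
    ; spots-injective = λ {c} {d} eq → spotOf-injective
                          (trans (sym (VecP.lookup∘tabulate spotOf c)) (trans eq (VecP.lookup∘tabulate spotOf d)))
    ; passed-taken = λ c j pref≤j j<spot →
        let d , d<c , spot≡j = passed-spot-taken c j pref≤j (subst (λ x → toℕ j < toℕ x) (VecP.lookup∘tabulate spotOf c) j<spot)
        in inj₂ (d , d<c , trans (VecP.lookup∘tabulate spotOf d) spot≡j)
    }

  parkingOf-corresponds : Corresponds f (parkingOf f)
  parkingOf-corresponds = record
    { tree = tree
    ; parkingFunction = parkingFunction
    ; pref≡rank-parent = toℕ-parkingOf
    ; 1+spot≡rank = λ c → trans (cong (λ ss → suc (toℕ (lookup ss c))) spots≡)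
                              (trans (cong (suc ∘ toℕ) (VecP.lookup∘tabulate spotOf c)) (1+spotOf c))
    }
    where
    parkingFunction : T (isParkingFunction (parkingOf f))
    parkingFunction = proj₁ (Parks⇒parkingFunction (parkingOf f) parks)
    spots≡ : spots (parkingOf f) ≡ tabulate spotOf
    spots≡ = proj₂ (Parks⇒parkingFunction (parkingOf f) parks)

module _ {n : ℕ} {a : Prefs n} (pf : T (isParkingFunction a)) where
  open Parks (parkingFunction⇒Parks a pf)

  private
    s : Fin n → Fin n
    s = lookup (spots a)
    ω : Fin n → Fin n
    ω = ωπ a
    g : ParentMap n
    g = treeOf a

  rankπ : Fin (suc n) → ℕ
  rankπ zero = 0
  rankπ (suc c) = suc (toℕ (s c))

  rankπ-vertexAtπ : ∀ k → rankπ (vertexAtπ a k) ≡ toℕ k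
  rankπ-vertexAtπ zero = refl
  rankπ-vertexAtπ (suc j) = cong (suc ∘ toℕ) (spots-ωπ a spots-injective j)

  rankπ-parent : ∀ c → rankπ (lookup g c) ≡ toℕ (lookup a c)
  rankπ-parent c = trans (cong rankπ (VecP.lookup-map c _ a)) (trans (rankπ-vertexAtπ _) (FinP.toℕ-inject₁ _))

  vertexAtπ-rankπ : ∀ v k → rankπ v ≡ toℕ k → vertexAtπ a k ≡ v
  vertexAtπ-rankπ zero zero _ = refl
  vertexAtπ-rankπ (suc c) (suc j) 1+sc≡1+j =
    cong suc (trans (cong ω (sym (FinP.toℕ-injective (ℕP.suc-injective 1+sc≡1+j)))) (ωπ-spots a spots-injective c))

  waiting-car-earlier : ∀ c k → rankπ (lookup g c) < toℕ k → toℕ k < rankπ (suc c) →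
                        toℕ (vertexAtπ a k) < toℕ (suc c)
  waiting-car-earlier c (suc j) pref<1+j 1+j<1+spot
    with passed-taken c j (ℕP.≤-pred (subst (_< suc (toℕ j)) (rankπ-parent c) pref<1+j)) (ℕP.≤-pred 1+j<1+spot)
  ... | inj₁ occupied = contradiction occupied (empty-street j)
  ... | inj₂ (d , d<c , refl) = s≤s (subst (λ x → toℕ x < toℕ c) (sym (ωπ-spots a spots-injective d)) d<c)

  treeOf-isPriorityOrder : IsPriorityOrder g rankπ (vertexAtπ a)
  treeOf-isPriorityOrder = record
    { rank-vertexAt = rankπ-vertexAtπ
    ; vertexAt-rank = vertexAtπ-rankπ
    ; rank< = λ { zero → s≤s z≤n ; (suc c) → s≤s (FinP.toℕ<n (s c)) }
    ; parent-first = λ c → s≤s (subst (_≤ toℕ (s c)) (sym (rankπ-parent c)) (pref≤spot c))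
    ; waiting-smaller = waiting-car-earlier
    }

  treeOf-corresponds : Corresponds g a
  treeOf-corresponds = record
    { tree = tree
    ; parkingFunction = pf
    ; pref≡rank-parent = λ c → sym (trans (ranks-agree (lookup g c)) (rankπ-parent c))
    ; 1+spot≡rank = λ c → sym (ranks-agree (suc c))
    }
    where
    tree : T (isTree g)
    tree = PriorityOrder.isTree-holds treeOf-isPriorityOrder
    ranks-agree : ∀ v → ωT⁻¹ g v ≡ rankπ v
    ranks-agree = rank-unique (isTree⇒isPriorityOrder tree) treeOf-isPriorityOrder

theorem4p1 : (n : ℕ) (v : Hexad n) → #treesWith n v ≡ #pfsWith n v
theorem4p1 n v = countᵇ-bijection (λ f → ⌊ hexadT f ≟H v ⌋) (λ a → ⌊ hexadP a ≟H v ⌋) parkingOf treeOf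
  (UniqueP.filter⁺ _ (allVecs-unique (suc n) n))
  (UniqueP.filter⁺ _ (allVecs-unique n n))
  (λ f∈ → from ∈PFs (Corresponds.parkingFunction (tree-side f∈)))
  (λ a∈ → from ∈trees (Corresponds.tree (parking-side a∈)))
  (λ f∈ → Correspondence.treeOf≡ (tree-side f∈))
  (λ a∈ → Correspondence.parkingOf≡ (parking-side a∈))
  (λ f∈ → cong (λ h → ⌊ h ≟H v ⌋) (Correspondence.hexadP≡hexadT (tree-side f∈)))
  where
  ∈trees : ∀ {f} → f ∈ CayleyTrees n ⇔ T (isTree f)
  ∈trees = ∈-filterᵇ-allVecs isTree
  ∈PFs : ∀ {a} → a ∈ ParkingFunctions n ⇔ T (isParkingFunction a)
  ∈PFs = ∈-filterᵇ-allVecs isParkingFunction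
  tree-side : ∀ {f} → f ∈ CayleyTrees n → Corresponds f (parkingOf f)
  tree-side f∈ = parkingOf-corresponds (to ∈trees f∈)
  parking-side : ∀ {a} → a ∈ ParkingFunctions n → Corresponds (treeOf a) a
  parking-side a∈ = treeOf-corresponds (to ∈PFs a∈)
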